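{- For all positive integers $n,t$, $\mathrm{Ehr}_{P_n}(t)=\mathrm{Ehr}_{Q_n}(t)=(t+1)^n-t^n$.
   Context: Let $\Omega$ be the $n\times n$ matrix with $(i,j)$-entry $j\binom{i+1}{j+1}$, and let $P_n\subseteq\mathbb{R}^n$ be the convex hull of the rows of $\Omega$. Let $Q_n\subseteq\mathbb{R}^n$ be the convex hull of the points $\lambda^l=(1,2,\dots,l,0,\dots,0)$ for $l\in[n]$. For a polytope $P\subseteq\mathbb{R}^d$ and $t\in\mathbb{N}$, $\mathrm{Ehr}_P(t)$ is the number of points of $\mathbb{Z}^d$ in the dilation $tP=\{tx: x\in P\}$. -}

module Defs where

open import Data.Nat as ℕ using (ℕ; zero; suc)
open import Data.Nat.Combinatorics using (_C_)
open import Data.Integer as ℤ using (ℤ)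
open import Data.Rational as ℚ using (ℚ)
open import Data.Fin as Fin using (Fin; toℕ)
open import Data.Vec using (Vec; lookup)
open import Data.List using (List; length)
open import Data.List.Membership.Propositional using (_∈_)
open import Data.List.Relation.Unary.Unique.Propositional using (Unique)
open import Data.Product using (Σ; _×_; ∃)
open import Function.Bundles using (_⇔_)
open import Relation.Binary.PropositionalEquality using (_≡_)
import Relation.Nullary

sumℚ : ∀ {m} → (Fin m → ℚ) → ℚ
sumℚ {zero}  f = ℚ.0ℚ
sumℚ {suc m} f = f Fin.zero ℚ.+ sumℚ (λ i → f (Fin.suc i))

-- x ∈ t · conv{v₀,…,v_{m-1}} (convex combination with rational weights;
-- for rational vertices and a rational point this agrees with real convexity).
InDilatedHull : ∀ {m n} → (Fin m → Fin n → ℤ) → ℕ → Vec ℤ n → Set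
InDilatedHull {m} {n} v t x =
  Σ (Fin m → ℚ) λ w →
    (∀ i → ℚ.0ℚ ℚ.≤ w i) ×
    (sumℚ w ≡ ℚ.1ℚ) ×
    (∀ j → ℚ._/_ (lookup x j) 1 ≡
           ℚ._/_ (ℤ.+ t) 1 ℚ.* sumℚ (λ i → w i ℚ.* ℚ._/_ (v i j) 1))

-- Ehr_{conv(v)}(t) = c : the integer points of t·conv(v) are exactly the
-- elements of a duplicate-free list of length c.
EhrIs : ∀ {m n} → (Fin m → Fin n → ℤ) → ℕ → ℕ → Set
EhrIs {m} {n} v t c =
  Σ (List (Vec ℤ n)) λ L →
    Unique L ×
    (∀ x → (x ∈ L) ⇔ InDilatedHull v t x) ×
    (length L ≡ c)

-- Ω_{ij} = j · binom(i+1, j+1), with 1-indexed i,j; rows i ∈ [n].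
-- With 0-indexed a,b (i = a+1, j = b+1): (b+1) · binom(a+2, b+2).
Ω : (n : ℕ) → Fin n → Fin n → ℤ
Ω n a b = ℤ.+ (suc (toℕ b) ℕ.* (suc (suc (toℕ a)) C suc (suc (toℕ b))))

-- λ^l = (1,2,…,l,0,…,0), l ∈ [n]; row a (0-indexed) is λ^{a+1}.
-- Coordinate k (1-indexed, k = b+1) equals k if k ≤ l and 0 otherwise.
Λ : (n : ℕ) → Fin n → Fin n → ℤ
Λ n a b with toℕ b ℕ.<? suc (toℕ a)
... | Relation.Nullary.yes _ = ℤ.+ suc (toℕ b)
... | Relation.Nullary.no  _ = ℤ.+ 0

-- Writing a point of t·Q_n as t times a convex combination of the λ^l, its coordinates are
-- x_j = t j S_j where S_j is the total weight of the λ^l with l ≥ j. Hence x lies in t·Q_n iff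
-- x_1 = t, x_{j+1}/(j+1) ≤ x_j/j and x_n ≥ 0. The substitution z_j = j t - x_j turns its lattice
-- points into chains 0 = z_1, z_j/j non-decreasing, z_n ≤ n t, which are enumerated recursively
-- from z_n down; the number of chains with z_n ≤ n q + j obeys a two-step recurrence solved by
-- (q+1)^(n-j) (q+2)^j - q^(n-j) (q+1)^j, which is (t+1)^n - t^n at q = t, j = 0.
-- For P_n, the hockey-stick identity gives Ω = Λ T with T_{kj} = binom(k, j) (rows of Λ being the
-- λ^l). As T is unitriangular over ℤ, y ↦ y T maps the lattice points of t·Q_n bijectively onto
-- those of t·P_n.

module Submission where

open import Algebra.Bundles using (CommutativeSemiring; CommutativeRing; CommutativeMonoid)
open import Data.Nat as ℕ using (ℕ; zero; suc; z≤n; s≤s; _<_; _≤_)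

module Sum {c ℓ} (R : CommutativeSemiring c ℓ) where

  open CommutativeSemiring R
  open import Relation.Binary.Reasoning.Setoid setoid
  open import Algebra.Properties.CommutativeSemigroup +-commutativeSemigroup
    using () renaming (interchange to +-interchange)

  ∑ : ℕ → (ℕ → Carrier) → Carrier
  ∑ zero    f = 0#
  ∑ (suc n) f = f 0 + ∑ n (λ k → f (suc k))

  ∑-cong : ∀ n {f g} → (∀ k → k < n → f k ≈ g k) → ∑ n f ≈ ∑ n g
  ∑-cong zero    f≈g = refl
  ∑-cong (suc n) f≈g = +-cong (f≈g 0 (s≤s z≤n)) (∑-cong n (λ k k<n → f≈g (suc k) (s≤s k<n)))

  ∑-zero : ∀ n → ∑ n (λ _ → 0#) ≈ 0#
  ∑-zero zero    = refl
  ∑-zero (suc n) = trans (+-identityˡ _) (∑-zero n)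

  ∑-snoc : ∀ n f → ∑ (suc n) f ≈ ∑ n f + f n
  ∑-snoc zero    f = +-comm (f 0) 0#
  ∑-snoc (suc n) f = begin
    f 0 + ∑ (suc n) (λ k → f (suc k))         ≈⟨ +-congˡ (∑-snoc n (λ k → f (suc k))) ⟩
    f 0 + (∑ n (λ k → f (suc k)) + f (suc n)) ≈⟨ +-assoc _ _ _ ⟨
    ∑ (suc n) f + f (suc n)                   ∎

  ∑-distrib-+ : ∀ n f g → ∑ n (λ k → f k + g k) ≈ ∑ n f + ∑ n g
  ∑-distrib-+ zero    f g = sym (+-identityˡ 0#)
  ∑-distrib-+ (suc n) f g = begin
    (f 0 + g 0) + ∑ n (λ k → f (suc k) + g (suc k))               ≈⟨ +-congˡ (∑-distrib-+ n _ _) ⟩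
    (f 0 + g 0) + (∑ n (λ k → f (suc k)) + ∑ n (λ k → g (suc k))) ≈⟨ +-interchange _ _ _ _ ⟩
    ∑ (suc n) f + ∑ (suc n) g                                     ∎

  *-distribˡ-∑ : ∀ n a f → a * ∑ n f ≈ ∑ n (λ k → a * f k)
  *-distribˡ-∑ zero    a f = zeroʳ a
  *-distribˡ-∑ (suc n) a f = trans (distribˡ a _ _) (+-congˡ (*-distribˡ-∑ n a _))

  *-distribʳ-∑ : ∀ n a f → ∑ n f * a ≈ ∑ n (λ k → f k * a)
  *-distribʳ-∑ zero    a f = zeroˡ a
  *-distribʳ-∑ (suc n) a f = trans (distribʳ a _ _) (+-congˡ (*-distribʳ-∑ n a _))

  ∑-comm : ∀ m n F → ∑ m (λ i → ∑ n (F i)) ≈ ∑ n (λ k → ∑ m (λ i → F i k))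
  ∑-comm zero    n F = sym (∑-zero n)
  ∑-comm (suc m) n F = begin
    ∑ n (F 0) + ∑ m (λ i → ∑ n (F (suc i)))         ≈⟨ +-congˡ (∑-comm m n (λ i → F (suc i))) ⟩
    ∑ n (F 0) + ∑ n (λ k → ∑ m (λ i → F (suc i) k)) ≈⟨ ∑-distrib-+ n (F 0) (λ k → ∑ m (λ i → F (suc i) k)) ⟨
    ∑ n (λ k → ∑ (suc m) (λ i → F i k))             ∎

  ∑-truncate : ∀ {m n} f → m ≤ n → (∀ k → m ≤ k → f k ≈ 0#) → ∑ n f ≈ ∑ m f
  ∑-truncate {zero}  {n}     f _ vanish = trans (∑-cong n (λ k _ → vanish k z≤n)) (∑-zero n)
  ∑-truncate {suc m} {suc n} f (s≤s m≤n) vanish =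
    +-congˡ (∑-truncate (λ k → f (suc k)) m≤n (λ k m≤k → vanish (suc k) (s≤s m≤k)))

open import Defs
open import Data.Nat using (ℕ; suc; _+_; _^_; _∸_; _≥_)
open import Data.Product using (_×_)

import Data.Nat.Properties as ℕ
open import Data.Nat using (_*_)
open import Data.Nat.Combinatorics using (_C_; nCn≡1; k>n⇒nCk≡0; nCk+nC[k+1]≡[n+1]C[k+1])
open import Data.Nat.DivMod using (_/_; m*n/n≡m; m<n⇒m/n≡0; +-distrib-/-∣ˡ; m/n*n≤m; /-monoˡ-≤)
open import Data.Nat.Divisibility using (divides-refl)
import Data.Nat.Tactic.RingSolver as ℕ-Solver
open import Data.Integer as ℤ using (ℤ; +_)
import Data.Integer.Properties as ℤ
import Data.Integer.Tactic.RingSolver as ℤ-Solver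
open import Data.Rational as ℚ using (ℚ; 0ℚ; 1ℚ)
import Data.Rational.Properties as ℚ
import Data.Rational.Unnormalised as ℚᵘ
import Data.Rational.Unnormalised.Properties as ℚᵘ
open import Data.Rational.Solver using (module +-*-Solver)
open import Data.Fin as Fin using (Fin; toℕ; fromℕ<)
import Data.Fin.Properties as Fin
open import Data.Vec as Vec using (Vec; []; _∷_; lookup; tabulate)
import Data.Vec.Properties as Vec
open import Data.List as List using (List; _++_; map; length)
import Data.List.Properties as List
open import Data.List.Membership.Propositional using (_∈_)
open import Data.List.Membership.Propositional.Properties using (∈-map⁺; ∈-map⁻; ∈-++⁺ˡ; ∈-++⁺ʳ; ∈-++⁻)
open import Data.List.Relation.Unary.Any using (here)
import Data.List.Relation.Unary.All as All
import Data.List.Relation.Unary.AllPairs as AllPairs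
open import Data.List.Relation.Unary.Unique.Propositional using (Unique)
import Data.List.Relation.Unary.Unique.Propositional.Properties as Unique
open import Data.Empty using (⊥)
open import Data.Product using (Σ; _,_; proj₁; ∃)
open import Data.Sum using ([_,_]′; inj₁; inj₂)
open import Function.Base using (id)
open import Function.Bundles using (_⇔_; mk⇔; Equivalence)
open import Function.Properties.Equivalence using (⇔-setoid)
open import Level using (0ℓ)
open import Relation.Nullary using (yes; no; contradiction)
open import Relation.Binary.PropositionalEquality
import Algebra.Properties.CommutativeSemigroup ℕ.*-commutativeSemigroup as ℕ-*
import Algebra.Properties.CommutativeSemigroup (CommutativeMonoid.commutativeSemigroup ℚ.*-1-commutativeMonoid) as ℚ-*
import Algebra.Properties.Group ℚ.+-0-group as ℚ-+
open import Algebra.Properties.Quasigroup ℚ-+.quasigroup using (x≈z//y)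

open Sum (CommutativeRing.commutativeSemiring ℚ.+-*-commutativeRing)
module ℤΣ = Sum ℤ.+-*-commutativeSemiring
module ℕΣ = Sum ℕ.+-*-commutativeSemiring

infix 7.5 _/1

opaque
  _/1 : ℤ → ℚ
  z /1 = z ℚ./ 1

opaque
  unfolding _/1

  /1-def : ∀ z → z /1 ≡ z ℚ./ 1
  /1-def z = refl

  /1-zero : + 0 /1 ≡ 0ℚ
  /1-zero = refl

  /1-one : + 1 /1 ≡ 1ℚ
  /1-one = refl

  toℚᵘ-/1 : ∀ z → ℚ.toℚᵘ (z /1) ℚᵘ.≃ ℚᵘ.mkℚᵘ z 0
  toℚᵘ-/1 z = ℚ.toℚᵘ-fromℚᵘ (ℚᵘ.mkℚᵘ z 0)

/1-injective : ∀ {a b} → a /1 ≡ b /1 → a ≡ b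
/1-injective {a} {b} eq
  with ℚᵘ.*≡* p ← ℚᵘ.≃-trans (ℚᵘ.≃-sym (toℚᵘ-/1 a)) (ℚᵘ.≃-trans (ℚ.toℚᵘ-cong eq) (toℚᵘ-/1 b))
  = trans (sym (ℤ.*-identityʳ a)) (trans p (ℤ.*-identityʳ b))

private
  viaℚᵘ : ∀ {p q : ℚ} {u v : ℚᵘ.ℚᵘ} → ℚ.toℚᵘ p ℚᵘ.≃ u → ℚ.toℚᵘ q ℚᵘ.≃ v → u ℚᵘ.≃ v → p ≡ q
  viaℚᵘ p≃u q≃v u≃v = ℚ.toℚᵘ-injective (ℚᵘ.≃-trans p≃u (ℚᵘ.≃-trans u≃v (ℚᵘ.≃-sym q≃v)))

/1-homo-+ : ∀ a b → (a ℤ.+ b) /1 ≡ a /1 ℚ.+ b /1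
/1-homo-+ a b = viaℚᵘ (toℚᵘ-/1 (a ℤ.+ b))
  (ℚᵘ.≃-trans (ℚ.toℚᵘ-homo-+ (a /1) (b /1)) (ℚᵘ.+-cong (toℚᵘ-/1 a) (toℚᵘ-/1 b)))
  (ℚᵘ.*≡* (identity a b))
  where
  identity : ∀ a b → (a ℤ.+ b) ℤ.* + 1 ≡ (a ℤ.* + 1 ℤ.+ b ℤ.* + 1) ℤ.* + 1
  identity = ℤ-Solver.solve-∀

/1-homo-* : ∀ a b → (a ℤ.* b) /1 ≡ a /1 ℚ.* b /1
/1-homo-* a b = viaℚᵘ (toℚᵘ-/1 (a ℤ.* b))
  (ℚᵘ.≃-trans (ℚ.toℚᵘ-homo-* (a /1) (b /1)) (ℚᵘ.*-cong (toℚᵘ-/1 a) (toℚᵘ-/1 b)))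
  (ℚᵘ.*≡* refl)

/1-homo-minus : ∀ a b → (a ℤ.- b) /1 ≡ a /1 ℚ.- b /1
/1-homo-minus a b = trans (/1-homo-+ a (ℤ.- b)) (cong (a /1 ℚ.+_) (viaℚᵘ (toℚᵘ-/1 (ℤ.- b))
  (ℚᵘ.≃-trans (ℚ.toℚᵘ-homo‿- (b /1)) (ℚᵘ.-‿cong (toℚᵘ-/1 b))) ℚᵘ.≃-refl))

/1-mono-≤ : ∀ {a b} → a ℤ.≤ b → a /1 ℚ.≤ b /1
/1-mono-≤ {a} {b} a≤b = ℚ.toℚᵘ-cancel-≤
  (ℚᵘ.≤-respʳ-≃ (ℚᵘ.≃-sym (toℚᵘ-/1 b)) (ℚᵘ.≤-respˡ-≃ (ℚᵘ.≃-sym (toℚᵘ-/1 a))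
    (ℚᵘ.*≤* (subst₂ ℤ._≤_ (sym (ℤ.*-identityʳ a)) (sym (ℤ.*-identityʳ b)) a≤b))))

/1-cancel-≤ : ∀ {a b} → a /1 ℚ.≤ b /1 → a ℤ.≤ b
/1-cancel-≤ {a} {b} le
  with ℚᵘ.*≤* p ← ℚᵘ.≤-respʳ-≃ (toℚᵘ-/1 b) (ℚᵘ.≤-respˡ-≃ (toℚᵘ-/1 a) (ℚ.toℚᵘ-mono-≤ le))
  = subst₂ ℤ._≤_ (ℤ.*-identityʳ a) (ℤ.*-identityʳ b) p

+/1-nonNeg : ∀ n → 0ℚ ℚ.≤ + n /1
+/1-nonNeg n = subst (ℚ._≤ + n /1) /1-zero (/1-mono-≤ (ℤ.+≤+ z≤n))

1/[1+_] : ℕ → ℚ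
1/[1+ d ] = + 1 ℚ./ suc d

*-1/[1+]-inverseʳ : ∀ d → + suc d /1 ℚ.* 1/[1+ d ] ≡ 1ℚ
*-1/[1+]-inverseʳ d = viaℚᵘ
  (ℚᵘ.≃-trans (ℚ.toℚᵘ-homo-* (+ suc d /1) 1/[1+ d ])
    (ℚᵘ.*-cong (toℚᵘ-/1 (+ suc d)) (ℚ.toℚᵘ-fromℚᵘ (ℚᵘ.mkℚᵘ (+ 1) d))))
  ℚᵘ.≃-refl
  (ℚᵘ.*≡* (trans (ℤ.*-identityʳ _) (trans (ℤ.*-identityʳ _)
    (sym (trans (ℤ.*-identityˡ _) (cong +_ (ℕ.*-identityˡ (suc d))))))))

1/[1+]-nonNeg : ∀ d → 0ℚ ℚ.≤ 1/[1+ d ]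
1/[1+]-nonNeg d = ℚ.toℚᵘ-cancel-≤
  (ℚᵘ.≤-respʳ-≃ (ℚᵘ.≃-sym (ℚ.toℚᵘ-fromℚᵘ (ℚᵘ.mkℚᵘ (+ 1) d))) (ℚᵘ.*≤* (ℤ.+≤+ z≤n)))

*-nonNeg : ∀ {p q} → 0ℚ ℚ.≤ p → 0ℚ ℚ.≤ q → 0ℚ ℚ.≤ p ℚ.* q
*-nonNeg {p} {q} 0≤p 0≤q =
  subst (ℚ._≤ p ℚ.* q) (ℚ.*-zeroʳ p) (ℚ.*-monoˡ-≤-nonNeg p {{ℚ.nonNegative 0≤p}} 0≤q)

∑-nonNeg : ∀ n f → (∀ k → k < n → 0ℚ ℚ.≤ f k) → 0ℚ ℚ.≤ ∑ n f
∑-nonNeg zero    f _   = ℚ.≤-refl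
∑-nonNeg (suc n) f 0≤f = ℚ.+-mono-≤ (0≤f 0 (s≤s z≤n)) (∑-nonNeg n _ (λ k k<n → 0≤f (suc k) (s≤s k<n)))

/1-homo-∑ : ∀ n f → ℤΣ.∑ n f /1 ≡ ∑ n (λ k → f k /1)
/1-homo-∑ zero    f = /1-zero
/1-homo-∑ (suc n) f = trans (/1-homo-+ (f 0) _) (cong (f 0 /1 ℚ.+_) (/1-homo-∑ n _))

pos-∑ : ∀ n f → + ℕΣ.∑ n f ≡ ℤΣ.∑ n (λ k → + f k)
pos-∑ zero    f = refl
pos-∑ (suc n) f = trans (ℤ.pos-+ (f 0) _) (cong (ℤ._+_ (+ f 0)) (pos-∑ n _))

at : ∀ {A : Set} {n} → A → Vec A n → ℕ → A
at d []       k       = d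
at d (x ∷ xs) zero    = x
at d (x ∷ xs) (suc k) = at d xs k

tabulateℕ : ∀ {A : Set} n → (ℕ → A) → Vec A n
tabulateℕ n f = tabulate (λ i → f (toℕ i))

module _ {A : Set} (d : A) where

  at-lookup : ∀ {n} (x : Vec A n) i → lookup x i ≡ at d x (toℕ i)
  at-lookup (x ∷ xs) Fin.zero    = refl
  at-lookup (x ∷ xs) (Fin.suc i) = at-lookup xs i

  at-fromℕ< : ∀ {n k} (x : Vec A n) (k<n : k < n) → at d x k ≡ lookup x (fromℕ< k<n)
  at-fromℕ< x k<n = trans (cong (at d x) (sym (Fin.toℕ-fromℕ< k<n))) (sym (at-lookup x _))

  at-beyond : ∀ {n k} (x : Vec A n) → n ≤ k → at d x k ≡ d
  at-beyond []       _         = refl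
  at-beyond (x ∷ xs) (s≤s n≤k) = at-beyond xs n≤k

  at-tabulateℕ : ∀ {n k} f → k < n → at d (tabulateℕ n f) k ≡ f k
  at-tabulateℕ {n} f k<n = trans (at-fromℕ< (tabulateℕ n f) k<n)
    (trans (Vec.lookup∘tabulate _ (fromℕ< k<n)) (cong f (Fin.toℕ-fromℕ< k<n)))

  at-injective : ∀ {n} (x y : Vec A n) → (∀ k → k < n → at d x k ≡ at d y k) → x ≡ y
  at-injective []       []       _ = refl
  at-injective (x ∷ xs) (y ∷ ys) eq =
    cong₂ _∷_ (eq 0 (s≤s z≤n)) (at-injective xs ys (λ k k<n → eq (suc k) (s≤s k<n)))

finite-choice : ∀ {A : Set} (d : A) n {P : ℕ → A → Set} → (∀ k → k < n → ∃ (P k)) →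
  Σ (Vec A n) λ y → ∀ k → k < n → P k (at d y k)
finite-choice d zero    choice = [] , λ _ ()
finite-choice d (suc n) choice with choice 0 (s≤s z≤n)
                                 | finite-choice d n (λ k k<n → choice (suc k) (s≤s k<n))
... | y₀ , P₀ | ys , Pys = y₀ ∷ ys , λ { zero _ → P₀ ; (suc k) (s≤s k<n) → Pys k k<n }

-- Dilated convex hulls

IsConvexWeighting : ℕ → (ℕ → ℚ) → Set
IsConvexWeighting m W = (∀ i → i < m → 0ℚ ℚ.≤ W i) × ∑ m W ≡ 1ℚ

rowMul : ℕ → (ℕ → ℚ) → (ℕ → ℕ → ℤ) → ℕ → ℚ
rowMul m W M j = ∑ m (λ i → W i ℚ.* M i j /1)

InDilatedHullℕ : ℕ → ℕ → (ℕ → ℕ → ℤ) → ℕ → (ℕ → ℚ) → Set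
InDilatedHullℕ m n M t X =
  Σ (ℕ → ℚ) λ W → IsConvexWeighting m W × (∀ j → j < n → X j ≡ + t /1 ℚ.* rowMul m W M j)

inDilatedHullℕ-cong : ∀ {m n M t X X′} → (∀ j → j < n → X j ≡ X′ j) →
  InDilatedHullℕ m n M t X → InDilatedHullℕ m n M t X′
inDilatedHullℕ-cong X≡X′ (W , weighting , X≡) = W , weighting , (λ j j<n → trans (sym (X≡X′ j j<n)) (X≡ j j<n))

sumℚ-∑ : ∀ n F → sumℚ {n} (λ i → F (toℕ i)) ≡ ∑ n F
sumℚ-∑ zero    F = refl
sumℚ-∑ (suc n) F = cong (F 0 ℚ.+_) (sumℚ-∑ n (λ k → F (suc k)))

sumℚ-cong : ∀ {n} {f g : Fin n → ℚ} → (∀ i → f i ≡ g i) → sumℚ f ≡ sumℚ g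
sumℚ-cong {zero}  f≡g = refl
sumℚ-cong {suc n} f≡g = cong₂ ℚ._+_ (f≡g Fin.zero) (sumℚ-cong (λ i → f≡g (Fin.suc i)))

module _ {m n} (v : Fin m → Fin n → ℤ) (M : ℕ → ℕ → ℤ)
         (v≡M : ∀ i j → v i j ≡ M (toℕ i) (toℕ j)) (t : ℕ) (x : Vec ℤ n) where

  private
    combination≡rowMul : ∀ (w : Fin m → ℚ) (W : ℕ → ℚ) → (∀ i → w i ≡ W (toℕ i)) → ∀ j →
      ℚ._/_ (+ t) 1 ℚ.* sumℚ (λ i → w i ℚ.* ℚ._/_ (v i j) 1) ≡ + t /1 ℚ.* rowMul m W M (toℕ j)
    combination≡rowMul w W w≡W j = cong₂ ℚ._*_ (sym (/1-def (+ t)))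
      (trans (sumℚ-cong (λ i → cong₂ ℚ._*_ (w≡W i) (trans (sym (/1-def (v i j))) (cong _/1 (v≡M i j)))))
             (sumℚ-∑ m (λ i → W i ℚ.* M i (toℕ j) /1)))

  inDilatedHull⇔ℕ : InDilatedHull v t x ⇔ InDilatedHullℕ m n M t (λ j → at (+ 0) x j /1)
  inDilatedHull⇔ℕ = mk⇔ to from
    where
    to : InDilatedHull v t x → InDilatedHullℕ m n M t (λ j → at (+ 0) x j /1)
    to (w , w≥0 , ∑w≡1 , x≡) = W , (W≥0 , ∑W≡1) , X≡
      where
      W : ℕ → ℚ
      W = at 0ℚ (tabulate w)
      w≡W : ∀ i → w i ≡ W (toℕ i)
      w≡W i = trans (sym (Vec.lookup∘tabulate w i)) (at-lookup 0ℚ (tabulate w) i)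
      W≥0 : ∀ i → i < m → 0ℚ ℚ.≤ W i
      W≥0 i i<m = subst (0ℚ ℚ.≤_) (trans (w≡W _) (cong W (Fin.toℕ-fromℕ< i<m))) (w≥0 (fromℕ< i<m))
      ∑W≡1 : ∑ m W ≡ 1ℚ
      ∑W≡1 = trans (sym (sumℚ-∑ m W)) (trans (sumℚ-cong (λ i → sym (w≡W i))) ∑w≡1)
      X≡ : ∀ j → j < n → at (+ 0) x j /1 ≡ + t /1 ℚ.* rowMul m W M j
      X≡ j j<n = begin
        at (+ 0) x j /1                                         ≡⟨ cong _/1 (at-fromℕ< (+ 0) x j<n) ⟩
        lookup x jᶠ /1                                          ≡⟨ /1-def _ ⟩
        lookup x jᶠ ℚ./ 1                                       ≡⟨ x≡ jᶠ ⟩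
        ℚ._/_ (+ t) 1 ℚ.* sumℚ (λ i → w i ℚ.* ℚ._/_ (v i jᶠ) 1) ≡⟨ combination≡rowMul w W w≡W jᶠ ⟩
        + t /1 ℚ.* rowMul m W M (toℕ jᶠ)                        ≡⟨ cong (λ k → + t /1 ℚ.* rowMul m W M k) (Fin.toℕ-fromℕ< j<n) ⟩
        + t /1 ℚ.* rowMul m W M j                               ∎
        where
        open ≡-Reasoning
        jᶠ : Fin n
        jᶠ = fromℕ< j<n
    from : InDilatedHullℕ m n M t (λ j → at (+ 0) x j /1) → InDilatedHull v t x
    from (W , (W≥0 , ∑W≡1) , X≡) = w , (λ i → W≥0 (toℕ i) (Fin.toℕ<n i)) , trans (sumℚ-∑ m W) ∑W≡1 , x≡
      where
      w : Fin m → ℚ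
      w i = W (toℕ i)
      x≡ : ∀ j → lookup x j ℚ./ 1 ≡ ℚ._/_ (+ t) 1 ℚ.* sumℚ (λ i → w i ℚ.* ℚ._/_ (v i j) 1)
      x≡ j = begin
        lookup x j ℚ./ 1                                       ≡⟨ sym (/1-def _) ⟩
        lookup x j /1                                          ≡⟨ cong _/1 (at-lookup (+ 0) x j) ⟩
        at (+ 0) x (toℕ j) /1                                  ≡⟨ X≡ (toℕ j) (Fin.toℕ<n j) ⟩
        + t /1 ℚ.* rowMul m W M (toℕ j)                        ≡⟨ combination≡rowMul w W (λ _ → refl) j ⟨
        ℚ._/_ (+ t) 1 ℚ.* sumℚ (λ i → w i ℚ.* ℚ._/_ (v i j) 1) ∎
        where open ≡-Reasoning

*-rowMul : ∀ n c Y T j → c ℚ.* rowMul n Y T j ≡ rowMul n (λ k → c ℚ.* Y k) T j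
*-rowMul n c Y T j = trans (*-distribˡ-∑ n c _) (∑-cong n (λ k _ → sym (ℚ.*-assoc c (Y k) _)))

rowMul-assoc : ∀ m n W M T (MT : ℕ → ℕ → ℤ) →
  (∀ i j → i < m → MT i j /1 ≡ ∑ n (λ k → M i k /1 ℚ.* T k j /1)) →
  ∀ j → rowMul m W MT j ≡ rowMul n (rowMul m W M) T j
rowMul-assoc m n W M T MT MT≡ j = begin
  ∑ m (λ i → W i ℚ.* MT i j /1)                           ≡⟨ ∑-cong m (λ i i<m → cong (W i ℚ.*_) (MT≡ i j i<m)) ⟩
  ∑ m (λ i → W i ℚ.* ∑ n (λ k → M i k /1 ℚ.* T k j /1))   ≡⟨ ∑-cong m (λ i _ → *-distribˡ-∑ n (W i) _) ⟩
  ∑ m (λ i → ∑ n (λ k → W i ℚ.* (M i k /1 ℚ.* T k j /1))) ≡⟨ ∑-comm m n (λ i k → W i ℚ.* (M i k /1 ℚ.* T k j /1)) ⟩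
  ∑ n (λ k → ∑ m (λ i → W i ℚ.* (M i k /1 ℚ.* T k j /1))) ≡⟨ ∑-cong n (λ k _ → ∑-cong m (λ i _ → sym (ℚ.*-assoc (W i) _ _))) ⟩
  ∑ n (λ k → ∑ m (λ i → W i ℚ.* M i k /1 ℚ.* T k j /1))   ≡⟨ ∑-cong n (λ k _ → sym (*-distribʳ-∑ m (T k j /1) _)) ⟩
  ∑ n (λ k → rowMul m W M k ℚ.* T k j /1)                 ∎
  where open ≡-Reasoning

module _ (m n : ℕ) (M T MT : ℕ → ℕ → ℤ)
         (MT≡M*T : ∀ i j → i < m → MT i j /1 ≡ ∑ n (λ k → M i k /1 ℚ.* T k j /1)) (t : ℕ) where

  private
    image : ∀ W j → + t /1 ℚ.* rowMul m W MT j ≡ rowMul n (λ k → + t /1 ℚ.* rowMul m W M k) T j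
    image W j = trans (cong (+ t /1 ℚ.*_) (rowMul-assoc m n W M T MT MT≡M*T j)) (*-rowMul n (+ t /1) _ T j)

  inDilatedHull-image : ∀ {d Y} → InDilatedHullℕ m n M t Y → InDilatedHullℕ m d MT t (λ j → rowMul n Y T j)
  inDilatedHull-image (W , weighting , Y≡) = W , weighting , λ j _ →
    trans (∑-cong n (λ k k<n → cong (ℚ._* T k j /1) (Y≡ k k<n))) (sym (image W j))

  inDilatedHull-preimage : ∀ {d X} → InDilatedHullℕ m d MT t X →
    Σ (ℕ → ℚ) λ Y → InDilatedHullℕ m n M t Y × (∀ j → j < d → X j ≡ rowMul n Y T j)
  inDilatedHull-preimage (W , weighting , X≡) =
    (λ k → + t /1 ℚ.* rowMul m W M k) , (W , weighting , λ _ _ → refl) , λ j j<d → trans (X≡ j j<d) (image W j)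

module Unitriangular (T : ℕ → ℕ → ℤ)
                     (T-upper-zero : ∀ {k j} → k < j → T k j ≡ + 0)
                     (T-diagonal : ∀ k → T k k ≡ + 1) where

  rowMul-last : ∀ n Y → rowMul (suc n) Y T n ≡ Y n
  rowMul-last n Y = begin
    rowMul (suc n) Y T n                ≡⟨ ∑-snoc n _ ⟩
    rowMul n Y T n ℚ.+ Y n ℚ.* T n n /1 ≡⟨ cong₂ (λ a b → a ℚ.+ Y n ℚ.* b /1) (∑-cong n below) (T-diagonal n) ⟩
    ∑ n (λ _ → 0ℚ) ℚ.+ Y n ℚ.* + 1 /1   ≡⟨ cong (λ z → ∑ n (λ _ → 0ℚ) ℚ.+ Y n ℚ.* z) /1-one ⟩
    ∑ n (λ _ → 0ℚ) ℚ.+ Y n ℚ.* 1ℚ       ≡⟨ cong₂ ℚ._+_ (∑-zero n) (ℚ.*-identityʳ (Y n)) ⟩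
    0ℚ ℚ.+ Y n                          ≡⟨ ℚ.+-identityˡ (Y n) ⟩
    Y n                                 ∎
    where
    open ≡-Reasoning
    below : ∀ k → k < n → Y k ℚ.* T k n /1 ≡ 0ℚ
    below k k<n = trans (cong (λ z → Y k ℚ.* z /1) (T-upper-zero k<n)) (trans (cong (Y k ℚ.*_) /1-zero) (ℚ.*-zeroʳ (Y k)))

  rowMul-init : ∀ n Y j → rowMul n Y T j ≡ rowMul (suc n) Y T j ℚ.- Y n ℚ.* T n j /1
  rowMul-init n Y j = x≈z//y _ _ _ (sym (∑-snoc n _))

  unitriangular-injective : ∀ n A B → (∀ j → j < n → rowMul n A T j ≡ rowMul n B T j) →
                            ∀ k → k < n → A k ≡ B k
  unitriangular-injective (suc n) A B AT≡BT k k<1+n =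
    [ unitriangular-injective n A B init-equal k , (λ k≡n → subst (λ k → A k ≡ B k) (sym k≡n) last-equal) ]′
    (ℕ.m<1+n⇒m<n∨m≡n k<1+n)
    where
    last-equal : A n ≡ B n
    last-equal = trans (sym (rowMul-last n A)) (trans (AT≡BT n ℕ.≤-refl) (rowMul-last n B))
    init-equal : ∀ j → j < n → rowMul n A T j ≡ rowMul n B T j
    init-equal j j<n = trans (rowMul-init n A j) (trans (cong₂ (λ a b → a ℚ.- b ℚ.* T n j /1)
      (AT≡BT j (ℕ.m<n⇒m<1+n j<n)) last-equal) (sym (rowMul-init n B j)))

  unitriangular-integral : ∀ n Y x → (∀ j → j < n → rowMul n Y T j ≡ x j /1) →
                           ∀ k → k < n → ∃ λ z → Y k ≡ z /1
  unitriangular-integral (suc n) Y x YT≡x k k<1+n =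
    [ unitriangular-integral n Y x′ init-integral k , (λ k≡n → x n , subst (λ k → Y k ≡ x n /1) (sym k≡n) last-integral) ]′
    (ℕ.m<1+n⇒m<n∨m≡n k<1+n)
    where
    last-integral : Y n ≡ x n /1
    last-integral = trans (sym (rowMul-last n Y)) (YT≡x n ℕ.≤-refl)
    x′ : ℕ → ℤ
    x′ j = x j ℤ.- x n ℤ.* T n j
    init-integral : ∀ j → j < n → rowMul n Y T j ≡ x′ j /1
    init-integral j j<n = begin
      rowMul n Y T j                            ≡⟨ rowMul-init n Y j ⟩
      rowMul (suc n) Y T j ℚ.- Y n ℚ.* T n j /1 ≡⟨ cong₂ (λ a b → a ℚ.- b ℚ.* T n j /1) (YT≡x j (ℕ.m<n⇒m<1+n j<n)) last-integral ⟩
      x j /1 ℚ.- x n /1 ℚ.* T n j /1            ≡⟨ cong (x j /1 ℚ.-_) (/1-homo-* (x n) (T n j)) ⟨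
      x j /1 ℚ.- (x n ℤ.* T n j) /1             ≡⟨ /1-homo-minus (x j) _ ⟨
      x′ j /1                                   ∎
      where open ≡-Reasoning

-- Ω = Λ T with T the binomial matrix

[k+1]*[n+1]C[k+1]≡[n+1]*nCk : ∀ n k → suc k * (suc n C suc k) ≡ suc n * (n C k)
[k+1]*[n+1]C[k+1]≡[n+1]*nCk zero    zero    = refl
[k+1]*[n+1]C[k+1]≡[n+1]*nCk zero    (suc k) = ℕ.*-zeroʳ (suc (suc k))
[k+1]*[n+1]C[k+1]≡[n+1]*nCk (suc n) k       = begin
  suc k * (suc (suc n) C suc k)                     ≡⟨ cong (suc k *_) (nCk+nC[k+1]≡[n+1]C[k+1] (suc n) k) ⟨
  suc k * (suc n C k + suc n C suc k)               ≡⟨ ℕ.*-distribˡ-+ (suc k) (suc n C k) _ ⟩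
  suc k * (suc n C k) + suc k * (suc n C suc k)     ≡⟨ cong (_+_ (suc k * (suc n C k))) ([k+1]*[n+1]C[k+1]≡[n+1]*nCk n k) ⟩
  suc k * (suc n C k) + suc n * (n C k)             ≡⟨ ℕ.+-assoc (suc n C k) _ _ ⟩
  (suc n C k) + (k * (suc n C k) + suc n * (n C k)) ≡⟨ cong (_+_ (suc n C k)) (k*[n+1]Ck k) ⟩
  suc (suc n) * (suc n C k)                         ∎
  where
  open ≡-Reasoning
  k*[n+1]Ck : ∀ k → k * (suc n C k) + suc n * (n C k) ≡ suc n * (suc n C k)
  k*[n+1]Ck zero    = refl
  k*[n+1]Ck (suc k) = begin
    suc k * (suc n C suc k) + suc n * (n C suc k) ≡⟨ cong (_+ suc n * (n C suc k)) ([k+1]*[n+1]C[k+1]≡[n+1]*nCk n k) ⟩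
    suc n * (n C k) + suc n * (n C suc k)         ≡⟨ ℕ.*-distribˡ-+ (suc n) (n C k) _ ⟨
    suc n * (n C k + n C suc k)                   ≡⟨ cong (suc n *_) (nCk+nC[k+1]≡[n+1]C[k+1] n k) ⟩
    suc n * (suc n C suc k)                       ∎

∑[k+1]*kCb≡[b+1]*[m+1]C[b+2] : ∀ m b →
  ℕΣ.∑ m (λ k → suc k * (k C b)) ≡ suc b * (suc m C suc (suc b))
∑[k+1]*kCb≡[b+1]*[m+1]C[b+2] zero    b = sym (ℕ.*-zeroʳ (suc b))
∑[k+1]*kCb≡[b+1]*[m+1]C[b+2] (suc m) b = begin
  ℕΣ.∑ (suc m) (λ k → suc k * (k C b))                    ≡⟨ ℕΣ.∑-snoc m _ ⟩
  ℕΣ.∑ m (λ k → suc k * (k C b)) + suc m * (m C b)        ≡⟨ cong₂ _+_ (∑[k+1]*kCb≡[b+1]*[m+1]C[b+2] m b) (sym ([k+1]*[n+1]C[k+1]≡[n+1]*nCk m b)) ⟩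
  suc b * (suc m C suc (suc b)) + suc b * (suc m C suc b) ≡⟨ ℕ.*-distribˡ-+ (suc b) (suc m C suc (suc b)) (suc m C suc b) ⟨
  suc b * (suc m C suc (suc b) + suc m C suc b)           ≡⟨ cong (suc b *_) (ℕ.+-comm _ (suc m C suc b)) ⟩
  suc b * (suc m C suc b + suc m C suc (suc b))           ≡⟨ cong (suc b *_) (nCk+nC[k+1]≡[n+1]C[k+1] (suc m) (suc b)) ⟩
  suc b * (suc (suc m) C suc (suc b))                     ∎
  where open ≡-Reasoning

Λℕ : ℕ → ℕ → ℤ
Λℕ i j with j ℕ.<? suc i
... | yes _ = + suc j
... | no  _ = + 0

Λℕ-≤ : ∀ {i j} → j ≤ i → Λℕ i j ≡ + suc j
Λℕ-≤ {i} {j} j≤i with j ℕ.<? suc i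
... | yes _   = refl
... | no  j≰i = contradiction (s≤s j≤i) j≰i

Λℕ-> : ∀ {i j} → i < j → Λℕ i j ≡ + 0
Λℕ-> {i} {j} i<j with j ℕ.<? suc i
... | yes (s≤s j≤i) = contradiction i<j (ℕ.≤⇒≯ j≤i)
... | no  _         = refl

Ωℕ : ℕ → ℕ → ℤ
Ωℕ i j = + (suc j * (suc (suc i) C suc (suc j)))

binomial : ℕ → ℕ → ℤ
binomial k j = + (k C j)

binomial-upper : ∀ {k j} → k < j → binomial k j ≡ + 0
binomial-upper k<j = cong +_ (k>n⇒nCk≡0 k<j)

binomial-diagonal : ∀ k → binomial k k ≡ + 1
binomial-diagonal k = cong +_ (nCn≡1 k)

Ωℕ≡Λℕ*binomial : ∀ n i j → i < n → Ωℕ i j /1 ≡ ∑ n (λ k → Λℕ i k /1 ℚ.* binomial k j /1)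
Ωℕ≡Λℕ*binomial n i j i<n = sym (begin
  ∑ n (λ k → Λℕ i k /1 ℚ.* binomial k j /1)       ≡⟨ ∑-truncate _ i<n beyond ⟩
  ∑ (suc i) (λ k → Λℕ i k /1 ℚ.* binomial k j /1) ≡⟨ ∑-cong (suc i) within ⟩
  ∑ (suc i) (λ k → + (suc k * (k C j)) /1)        ≡⟨ /1-homo-∑ (suc i) (λ k → + (suc k * (k C j))) ⟨
  ℤΣ.∑ (suc i) (λ k → + (suc k * (k C j))) /1     ≡⟨ cong _/1 (pos-∑ (suc i) (λ k → suc k * (k C j))) ⟨
  + ℕΣ.∑ (suc i) (λ k → suc k * (k C j)) /1       ≡⟨ cong (λ z → + z /1) (∑[k+1]*kCb≡[b+1]*[m+1]C[b+2] (suc i) j) ⟩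
  Ωℕ i j /1                                       ∎)
  where
  open ≡-Reasoning
  beyond : ∀ k → suc i ≤ k → Λℕ i k /1 ℚ.* binomial k j /1 ≡ 0ℚ
  beyond k i<k = trans (cong (λ z → z /1 ℚ.* binomial k j /1) (Λℕ-> i<k))
                       (trans (cong (ℚ._* binomial k j /1) /1-zero) (ℚ.*-zeroˡ (binomial k j /1)))
  within : ∀ k → k < suc i → Λℕ i k /1 ℚ.* binomial k j /1 ≡ + (suc k * (k C j)) /1
  within k (s≤s k≤i) = trans (cong (λ z → z /1 ℚ.* binomial k j /1) (Λℕ-≤ k≤i))
                             (trans (sym (/1-homo-* (+ suc k) _)) (cong _/1 (sym (ℤ.pos-* (suc k) (k C j)))))

-- Halfspace description of t·Q_n

onlyFrom : ℕ → (ℕ → ℚ) → ℕ → ℚ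
onlyFrom j W i with j ℕ.<? suc i
... | yes _ = W i
... | no  _ = 0ℚ

onlyFrom-≤ : ∀ {j i} W → j ≤ i → onlyFrom j W i ≡ W i
onlyFrom-≤ {j} {i} W j≤i with j ℕ.<? suc i
... | yes _   = refl
... | no  j≰i = contradiction (s≤s j≤i) j≰i

onlyFrom-> : ∀ {j i} W → i < j → onlyFrom j W i ≡ 0ℚ
onlyFrom-> {j} {i} W i<j with j ℕ.<? suc i
... | yes (s≤s j≤i) = contradiction i<j (ℕ.≤⇒≯ j≤i)
... | no  _         = refl

tailSum : ℕ → (ℕ → ℚ) → ℕ → ℚ
tailSum m W j = ∑ m (onlyFrom j W)

tailSum-zero : ∀ m W → tailSum m W 0 ≡ ∑ m W
tailSum-zero m W = ∑-cong m (λ i _ → onlyFrom-≤ W z≤n)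

tailSum-suc : ∀ m W j → tailSum (suc m) W (suc j) ≡ tailSum m (λ i → W (suc i)) j
tailSum-suc m W j = begin
  onlyFrom (suc j) W 0 ℚ.+ ∑ m (λ i → onlyFrom (suc j) W (suc i)) ≡⟨ cong₂ ℚ._+_ (onlyFrom-> {suc j} W (s≤s z≤n)) (∑-cong m (λ i _ → onlyFrom-suc i)) ⟩
  0ℚ ℚ.+ tailSum m (λ i → W (suc i)) j                            ≡⟨ ℚ.+-identityˡ (tailSum m (λ i → W (suc i)) j) ⟩
  tailSum m (λ i → W (suc i)) j                                   ∎
  where
  open ≡-Reasoning
  onlyFrom-suc : ∀ i → onlyFrom (suc j) W (suc i) ≡ onlyFrom j (λ i → W (suc i)) i
  onlyFrom-suc i with j ℕ.≤? i
  ... | yes j≤i = trans (onlyFrom-≤ W (s≤s j≤i)) (sym (onlyFrom-≤ _ j≤i))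
  ... | no  j≰i = trans (onlyFrom-> W (s≤s (ℕ.≰⇒> j≰i))) (sym (onlyFrom-> _ (ℕ.≰⇒> j≰i)))

tailSum-step : ∀ m W j → j < m → tailSum m W j ≡ W j ℚ.+ tailSum m W (suc j)
tailSum-step (suc m) W zero    _         = cong₂ ℚ._+_ (onlyFrom-≤ W z≤n)
  (trans (∑-cong m (λ i _ → onlyFrom-≤ W z≤n)) (sym (tailSum-suc m W 0)))
tailSum-step (suc m) W (suc j) (s≤s j<m) = trans (tailSum-suc m W j)
  (trans (tailSum-step m _ j j<m) (cong (W (suc j) ℚ.+_) (sym (tailSum-suc m W (suc j)))))

tailSum-nonNeg : ∀ m W j → (∀ i → i < m → 0ℚ ℚ.≤ W i) → 0ℚ ℚ.≤ tailSum m W j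
tailSum-nonNeg m W j W≥0 = ∑-nonNeg m _ onlyFrom-nonNeg
  where
  onlyFrom-nonNeg : ∀ i → i < m → 0ℚ ℚ.≤ onlyFrom j W i
  onlyFrom-nonNeg i i<m with j ℕ.≤? i
  ... | yes j≤i = subst (0ℚ ℚ.≤_) (sym (onlyFrom-≤ W j≤i)) (W≥0 i i<m)
  ... | no  j≰i = subst (0ℚ ℚ.≤_) (sym (onlyFrom-> W (ℕ.≰⇒> j≰i))) ℚ.≤-refl

tailSum-antitone : ∀ m W j → (∀ i → i < m → 0ℚ ℚ.≤ W i) → j < m → tailSum m W (suc j) ℚ.≤ tailSum m W j
tailSum-antitone m W j W≥0 j<m = subst₂ ℚ._≤_ (ℚ.+-identityˡ _) (sym (tailSum-step m W j j<m))
  (ℚ.+-monoˡ-≤ (tailSum m W (suc j)) (W≥0 j j<m))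

tailSum-telescope : ∀ m D j → j ≤ m → tailSum m (λ i → D i ℚ.- D (suc i)) j ≡ D j ℚ.- D m
tailSum-telescope zero    D zero    _         = sym (ℚ.+-inverseʳ (D 0))
tailSum-telescope (suc m) D (suc j) (s≤s j≤m) = trans (tailSum-suc m _ j) (tailSum-telescope m (λ i → D (suc i)) j j≤m)
tailSum-telescope (suc m) D zero    _         = begin
  tailSum (suc m) Δ 0                   ≡⟨ tailSum-step (suc m) Δ 0 (s≤s z≤n) ⟩
  Δ 0 ℚ.+ tailSum (suc m) Δ 1           ≡⟨ cong (Δ 0 ℚ.+_) (trans (tailSum-suc m Δ 0) (tailSum-telescope m (λ i → D (suc i)) 0 z≤n)) ⟩
  (D 0 ℚ.- D 1) ℚ.+ (D 1 ℚ.- D (suc m)) ≡⟨ telescope (D 0) (D 1) (D (suc m)) ⟩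
  D 0 ℚ.- D (suc m)                     ∎
  where
  open ≡-Reasoning
  Δ : ℕ → ℚ
  Δ i = D i ℚ.- D (suc i)
  telescope : ∀ a b c → (a ℚ.- b) ℚ.+ (b ℚ.- c) ≡ a ℚ.- c
  telescope = solve 3 (λ a b c → (a :- b) :+ (b :- c) := a :- c) refl
    where open +-*-Solver

rowMul-Λℕ : ∀ m W j → rowMul m W Λℕ j ≡ tailSum m W j ℚ.* + suc j /1
rowMul-Λℕ m W j = trans (∑-cong m (λ i _ → term i)) (sym (*-distribʳ-∑ m (+ suc j /1) (onlyFrom j W)))
  where
  term : ∀ i → W i ℚ.* Λℕ i j /1 ≡ onlyFrom j W i ℚ.* + suc j /1
  term i with j ℕ.≤? i
  ... | yes j≤i = cong₂ (λ a b → a ℚ.* b /1) (sym (onlyFrom-≤ W j≤i)) (Λℕ-≤ j≤i)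
  ... | no  j≰i = begin
    W i ℚ.* Λℕ i j /1             ≡⟨ cong (λ z → W i ℚ.* z /1) (Λℕ-> (ℕ.≰⇒> j≰i)) ⟩
    W i ℚ.* + 0 /1                ≡⟨ cong (W i ℚ.*_) /1-zero ⟩
    W i ℚ.* 0ℚ                    ≡⟨ ℚ.*-zeroʳ (W i) ⟩
    0ℚ                            ≡⟨ ℚ.*-zeroˡ (+ suc j /1) ⟨
    0ℚ ℚ.* + suc j /1             ≡⟨ cong (ℚ._* + suc j /1) (onlyFrom-> W (ℕ.≰⇒> j≰i)) ⟨
    onlyFrom j W i ℚ.* + suc j /1 ∎
    where open ≡-Reasoning

QInequalities : ℕ → ℕ → (ℕ → ℤ) → Set
QInequalities n t x =
  (x 0 ≡ + t) ×
  (∀ k → suc k < n → + suc k ℤ.* x (suc k) ℤ.≤ + suc (suc k) ℤ.* x k) ×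
  (+ 0 ℤ.≤ x (ℕ.pred n))

private
  pull-factors : ∀ a b t s → a ℚ.* (t ℚ.* (s ℚ.* b)) ≡ (a ℚ.* b ℚ.* t) ℚ.* s
  pull-factors = solve 4 (λ a b t s → a :* (t :* (s :* b)) := (a :* b :* t) :* s) refl
    where open +-*-Solver

inDilatedHull-Λℕ⇒QInequalities : ∀ m t x →
  InDilatedHullℕ (suc m) (suc m) Λℕ t (λ j → x j /1) → QInequalities (suc m) t x
inDilatedHull-Λℕ⇒QInequalities m t x (W , (W≥0 , ∑W≡1) , X≡) = first , antitone , last
  where
  n = suc m
  x≡ : ∀ j → j < n → x j /1 ≡ + t /1 ℚ.* (tailSum n W j ℚ.* + suc j /1)
  x≡ j j<n = trans (X≡ j j<n) (cong (+ t /1 ℚ.*_) (rowMul-Λℕ n W j))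
  first : x 0 ≡ + t
  first = /1-injective (begin
    x 0 /1                                ≡⟨ x≡ 0 (s≤s z≤n) ⟩
    + t /1 ℚ.* (tailSum n W 0 ℚ.* + 1 /1) ≡⟨ cong₂ (λ a b → + t /1 ℚ.* (a ℚ.* b)) (trans (tailSum-zero n W) ∑W≡1) /1-one ⟩
    + t /1 ℚ.* (1ℚ ℚ.* 1ℚ)                ≡⟨ ℚ.*-identityʳ (+ t /1) ⟩
    + t /1                                ∎)
    where open ≡-Reasoning
  antitone : ∀ k → suc k < n → + suc k ℤ.* x (suc k) ℤ.≤ + suc (suc k) ℤ.* x k
  antitone k k+1<n = /1-cancel-≤ (subst₂ ℚ._≤_ (sym lhs) (sym rhs)
    (ℚ.*-monoˡ-≤-nonNeg c {{ℚ.nonNegative c≥0}} (tailSum-antitone n W k W≥0 k<n)))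
    where
    a b c : ℚ
    a = + suc k /1
    b = + suc (suc k) /1
    c = a ℚ.* b ℚ.* + t /1
    k<n : k < n
    k<n = ℕ.<-trans (ℕ.n<1+n k) k+1<n
    c≥0 : 0ℚ ℚ.≤ c
    c≥0 = *-nonNeg (*-nonNeg (+/1-nonNeg (suc k)) (+/1-nonNeg (suc (suc k)))) (+/1-nonNeg t)
    lhs : (+ suc k ℤ.* x (suc k)) /1 ≡ c ℚ.* tailSum n W (suc k)
    lhs = trans (/1-homo-* _ _) (trans (cong (a ℚ.*_) (x≡ (suc k) k+1<n)) (pull-factors a b (+ t /1) _))
    rhs : (+ suc (suc k) ℤ.* x k) /1 ≡ c ℚ.* tailSum n W k
    rhs = trans (/1-homo-* _ _) (trans (cong (b ℚ.*_) (x≡ k k<n))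
      (trans (pull-factors b a (+ t /1) _) (cong (λ z → z ℚ.* + t /1 ℚ.* tailSum n W k) (ℚ.*-comm b a))))
  last : + 0 ℤ.≤ x m
  last = /1-cancel-≤ (subst₂ ℚ._≤_ (sym /1-zero) (sym (x≡ m ℕ.≤-refl))
    (*-nonNeg (+/1-nonNeg t) (*-nonNeg (tailSum-nonNeg n W m W≥0) (+/1-nonNeg (suc m)))))

private
  *-rescale : ∀ a b c d → c ℚ.* d ≡ 1ℚ → a ℚ.* b ≡ (c ℚ.* a) ℚ.* (d ℚ.* b)
  *-rescale a b c d cd≡1 = trans (sym (ℚ.*-identityʳ (a ℚ.* b)))
    (trans (cong (a ℚ.* b ℚ.*_) (sym cd≡1)) (rearrange a b c d))
    where
    rearrange : ∀ a b c d → a ℚ.* b ℚ.* (c ℚ.* d) ≡ (c ℚ.* a) ℚ.* (d ℚ.* b)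
    rearrange = solve 4 (λ a b c d → a :* b :* (c :* d) := (c :* a) :* (d :* b)) refl
      where open +-*-Solver

  cancel-factors : ∀ t x r c s → t ℚ.* (x ℚ.* (r ℚ.* s) ℚ.* c) ≡ x ℚ.* ((c ℚ.* r) ℚ.* (t ℚ.* s))
  cancel-factors = solve 5 (λ t x r c s → t :* (x :* (r :* s) :* c) := x :* ((c :* r) :* (t :* s))) refl
    where open +-*-Solver

module _ (t′ : ℕ) (x : ℕ → ℤ) where

  normalised : ℕ → ℚ
  normalised k = x k /1 ℚ.* (1/[1+ k ] ℚ.* 1/[1+ t′ ])

  normalised-rescale : ∀ j → + suc t′ /1 ℚ.* (normalised j ℚ.* + suc j /1) ≡ x j /1
  normalised-rescale j = begin
    + suc t′ /1 ℚ.* (normalised j ℚ.* + suc j /1)                           ≡⟨ cancel-factors (+ suc t′ /1) (x j /1) 1/[1+ j ] (+ suc j /1) 1/[1+ t′ ] ⟩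
    x j /1 ℚ.* ((+ suc j /1 ℚ.* 1/[1+ j ]) ℚ.* (+ suc t′ /1 ℚ.* 1/[1+ t′ ])) ≡⟨ cong₂ (λ a b → x j /1 ℚ.* (a ℚ.* b)) (*-1/[1+]-inverseʳ j) (*-1/[1+]-inverseʳ t′) ⟩
    x j /1 ℚ.* (1ℚ ℚ.* 1ℚ)                                                  ≡⟨ ℚ.*-identityʳ (x j /1) ⟩
    x j /1                                                                  ∎
    where open ≡-Reasoning

  normalised-nonNeg : ∀ k → + 0 ℤ.≤ x k → 0ℚ ℚ.≤ normalised k
  normalised-nonNeg k 0≤x = *-nonNeg (subst (ℚ._≤ x k /1) /1-zero (/1-mono-≤ 0≤x))
    (*-nonNeg (1/[1+]-nonNeg k) (1/[1+]-nonNeg t′))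

  normalised-antitone : ∀ k → + suc k ℤ.* x (suc k) ℤ.≤ + suc (suc k) ℤ.* x k →
                        normalised (suc k) ℚ.≤ normalised k
  normalised-antitone k step = subst₂ ℚ._≤_ (sym lhs) (sym rhs)
    (ℚ.*-monoʳ-≤-nonNeg σ {{ℚ.nonNegative σ≥0}} (subst₂ ℚ._≤_ (/1-homo-* _ _) (/1-homo-* _ _) (/1-mono-≤ step)))
    where
    σ : ℚ
    σ = 1/[1+ k ] ℚ.* (1/[1+ suc k ] ℚ.* 1/[1+ t′ ])
    σ≥0 : 0ℚ ℚ.≤ σ
    σ≥0 = *-nonNeg (1/[1+]-nonNeg k) (*-nonNeg (1/[1+]-nonNeg (suc k)) (1/[1+]-nonNeg t′))
    lhs : normalised (suc k) ≡ + suc k /1 ℚ.* x (suc k) /1 ℚ.* σ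
    lhs = *-rescale (x (suc k) /1) _ (+ suc k /1) 1/[1+ k ] (*-1/[1+]-inverseʳ k)
    rhs : normalised k ≡ + suc (suc k) /1 ℚ.* x k /1 ℚ.* σ
    rhs = trans (*-rescale (x k /1) _ (+ suc (suc k) /1) 1/[1+ suc k ] (*-1/[1+]-inverseʳ (suc k)))
      (cong (+ suc (suc k) /1 ℚ.* x k /1 ℚ.*_) (ℚ-*.x∙yz≈y∙xz 1/[1+ suc k ] 1/[1+ k ] 1/[1+ t′ ]))

QInequalities⇒inDilatedHull-Λℕ : ∀ m t′ x → x (suc m) ≡ + 0 →
  QInequalities (suc m) (suc t′) x → InDilatedHullℕ (suc m) (suc m) Λℕ (suc t′) (λ j → x j /1)
QInequalities⇒inDilatedHull-Λℕ m t′ x x[n]≡0 (first , antitone , last) = W , (W≥0 , ∑W≡1) , X≡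
  where
  n = suc m
  S : ℕ → ℚ
  S = normalised t′ x
  -- S must be the tail sum of the weights, so these are its decrements
  W : ℕ → ℚ
  W i = S i ℚ.- S (suc i)
  S-last : S n ≡ 0ℚ
  S-last = trans (cong (λ z → z /1 ℚ.* (1/[1+ n ] ℚ.* 1/[1+ t′ ])) x[n]≡0)
    (trans (cong (ℚ._* (1/[1+ n ] ℚ.* 1/[1+ t′ ])) /1-zero) (ℚ.*-zeroˡ (1/[1+ n ] ℚ.* 1/[1+ t′ ])))
  tailSum-W : ∀ j → j ≤ n → tailSum n W j ≡ S j
  tailSum-W j j≤n = trans (tailSum-telescope n S j j≤n) (trans (cong (ℚ._-_ (S j)) S-last) (ℚ.+-identityʳ (S j)))
  ∑W≡1 : ∑ n W ≡ 1ℚ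
  ∑W≡1 = begin
    ∑ n W                                     ≡⟨ trans (sym (tailSum-zero n W)) (tailSum-W 0 z≤n) ⟩
    x 0 /1 ℚ.* (1/[1+ 0 ] ℚ.* 1/[1+ t′ ])     ≡⟨ cong (λ z → z /1 ℚ.* (1/[1+ 0 ] ℚ.* 1/[1+ t′ ])) first ⟩
    + suc t′ /1 ℚ.* (1ℚ ℚ.* 1/[1+ t′ ])       ≡⟨ cong (+ suc t′ /1 ℚ.*_) (ℚ.*-identityˡ 1/[1+ t′ ]) ⟩
    + suc t′ /1 ℚ.* 1/[1+ t′ ]                ≡⟨ *-1/[1+]-inverseʳ t′ ⟩
    1ℚ                                        ∎
    where open ≡-Reasoning
  X≡ : ∀ j → j < n → x j /1 ≡ + suc t′ /1 ℚ.* rowMul n W Λℕ j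
  X≡ j j<n = sym (trans (cong (+ suc t′ /1 ℚ.*_) (rowMul-Λℕ n W j))
    (trans (cong (λ z → + suc t′ /1 ℚ.* (z ℚ.* + suc j /1)) (tailSum-W j (ℕ.<⇒≤ j<n))) (normalised-rescale t′ x j)))
  W≥0 : ∀ i → i < n → 0ℚ ℚ.≤ W i
  W≥0 i i<n = subst (ℚ._≤ W i) (ℚ.+-inverseʳ (S (suc i))) (ℚ.+-monoˡ-≤ (ℚ.- S (suc i)) S-antitone)
    where
    S-antitone : S (suc i) ℚ.≤ S i
    S-antitone with ℕ.m<1+n⇒m<n∨m≡n i<n
    ... | inj₂ refl = subst (ℚ._≤ S m) (sym S-last) (normalised-nonNeg t′ x m last)
    ... | inj₁ i<m  = normalised-antitone t′ x i (antitone i (s≤s i<m))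

inDilatedHull-Λℕ⇔QInequalities : ∀ m t′ (y : Vec ℤ (suc m)) →
  InDilatedHullℕ (suc m) (suc m) Λℕ (suc t′) (λ j → at (+ 0) y j /1) ⇔ QInequalities (suc m) (suc t′) (at (+ 0) y)
inDilatedHull-Λℕ⇔QInequalities m t′ y = mk⇔ (inDilatedHull-Λℕ⇒QInequalities m (suc t′) (at (+ 0) y))
  (QInequalities⇒inDilatedHull-Λℕ m t′ (at (+ 0) y) (at-beyond (+ 0) y ℕ.≤-refl))

-- Lattice points of t·P_n

open Unitriangular binomial binomial-upper binomial-diagonal

binomialTransform : ℕ → (ℕ → ℤ) → ℕ → ℤ
binomialTransform n y j = ℤΣ.∑ n (λ k → y k ℤ.* binomial k j)

binomialTransform-/1 : ∀ n y j → binomialTransform n y j /1 ≡ rowMul n (λ k → y k /1) binomial j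
binomialTransform-/1 n y j = trans (/1-homo-∑ n _) (∑-cong n (λ k _ → /1-homo-* (y k) (binomial k j)))

binomialTransform-injective : ∀ n y y′ → (∀ j → j < n → binomialTransform n y j ≡ binomialTransform n y′ j) →
  ∀ k → k < n → y k ≡ y′ k
binomialTransform-injective n y y′ eq k k<n = /1-injective (unitriangular-injective n (λ k → y k /1) (λ k → y′ k /1)
  (λ j j<n → trans (sym (binomialTransform-/1 n y j)) (trans (cong _/1 (eq j j<n)) (binomialTransform-/1 n y′ j))) k k<n)

InBinomialImageOfQ : ℕ → ℕ → (ℕ → ℤ) → Set
InBinomialImageOfQ n t x =
  Σ (Vec ℤ n) λ y → QInequalities n t (at (+ 0) y) × (∀ j → j < n → x j ≡ binomialTransform n (at (+ 0) y) j)

inDilatedHull-Ωℕ⇔InBinomialImageOfQ : ∀ m t′ x →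
  InDilatedHullℕ (suc m) (suc m) Ωℕ (suc t′) (λ j → x j /1) ⇔ InBinomialImageOfQ (suc m) (suc t′) x
inDilatedHull-Ωℕ⇔InBinomialImageOfQ m t′ x = mk⇔ to from
  where
  n = suc m
  t = suc t′
  to : InDilatedHullℕ n n Ωℕ t (λ j → x j /1) → InBinomialImageOfQ n t x
  to hull =
    let Y , Y-hull , x≡YT = inDilatedHull-preimage n n Λℕ binomial Ωℕ (Ωℕ≡Λℕ*binomial n) t hull
        y , Y≡y = finite-choice (+ 0) n {P = λ k z → Y k ≡ z /1}
                    (unitriangular-integral n Y x (λ j j<n → sym (x≡YT j j<n)))
    in y , Equivalence.to (inDilatedHull-Λℕ⇔QInequalities m t′ y)
             (inDilatedHullℕ-cong {M = Λℕ} {X′ = λ k → at (+ 0) y k /1} Y≡y Y-hull) ,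
       x≡ Y y x≡YT Y≡y
    where
    x≡ : ∀ Y (y : Vec ℤ n) → (∀ j → j < n → x j /1 ≡ rowMul n Y binomial j) →
         (∀ k → k < n → Y k ≡ at (+ 0) y k /1) → ∀ j → j < n → x j ≡ binomialTransform n (at (+ 0) y) j
    x≡ Y y x≡YT Y≡y j j<n = /1-injective (begin
      x j /1                                      ≡⟨ x≡YT j j<n ⟩
      rowMul n Y binomial j                       ≡⟨ ∑-cong n (λ k k<n → cong (ℚ._* binomial k j /1) (Y≡y k k<n)) ⟩
      rowMul n (λ k → at (+ 0) y k /1) binomial j ≡⟨ binomialTransform-/1 n (at (+ 0) y) j ⟨
      binomialTransform n (at (+ 0) y) j /1       ∎)
      where open ≡-Reasoning
  from : InBinomialImageOfQ n t x → InDilatedHullℕ n n Ωℕ t (λ j → x j /1)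
  from (y , ineq , x≡) = inDilatedHullℕ-cong {M = Ωℕ}
    (λ j j<n → trans (sym (binomialTransform-/1 n (at (+ 0) y) j)) (cong _/1 (sym (x≡ j j<n))))
    (inDilatedHull-image n n Λℕ binomial Ωℕ (Ωℕ≡Λℕ*binomial n) t
      (Equivalence.from (inDilatedHull-Λℕ⇔QInequalities m t′ y) ineq))

-- Counting chains

consUpTo : ∀ {k} → (ℕ → List (Vec ℕ k)) → ℕ → List (Vec ℕ (suc k))
consUpTo g zero    = map (0 ∷_) (g 0)
consUpTo g (suc b) = consUpTo g b ++ map (suc b ∷_) (g (suc b))

module _ {k} (g : ℕ → List (Vec ℕ k)) where

  ∈-consUpTo⁻ : ∀ b {h r} → (h ∷ r) ∈ consUpTo g b → h ≤ b × r ∈ g h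
  ∈-consUpTo⁻ zero    h∷r∈ with ∈-map⁻ (0 ∷_) h∷r∈
  ... | _ , r∈ , refl = z≤n , r∈
  ∈-consUpTo⁻ (suc b) h∷r∈ with ∈-++⁻ (consUpTo g b) h∷r∈
  ... | inj₁ h∷r∈′ = let h≤b , r∈ = ∈-consUpTo⁻ b h∷r∈′ in ℕ.m≤n⇒m≤1+n h≤b , r∈
  ... | inj₂ h∷r∈′ with ∈-map⁻ (suc b ∷_) h∷r∈′
  ...   | _ , r∈ , refl = ℕ.≤-refl , r∈

  ∈-consUpTo⁺ : ∀ b {h r} → h ≤ b → r ∈ g h → (h ∷ r) ∈ consUpTo g b
  ∈-consUpTo⁺ zero    z≤n r∈ = ∈-map⁺ (0 ∷_) r∈
  ∈-consUpTo⁺ (suc b) h≤1+b r∈ with ℕ.m≤n⇒m<n∨m≡n h≤1+b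
  ... | inj₁ (s≤s h≤b) = ∈-++⁺ˡ (∈-consUpTo⁺ b h≤b r∈)
  ... | inj₂ refl      = ∈-++⁺ʳ (consUpTo g b) (∈-map⁺ (suc b ∷_) r∈)

  consUpTo-unique : (∀ h → Unique (g h)) → ∀ b → Unique (consUpTo g b)
  consUpTo-unique g-unique zero    = Unique.map⁺ Vec.∷-injectiveʳ (g-unique 0)
  consUpTo-unique g-unique (suc b) =
    Unique.++⁺ (consUpTo-unique g-unique b) (Unique.map⁺ Vec.∷-injectiveʳ (g-unique (suc b))) disjoint
    where
    disjoint : ∀ {v} → v ∈ consUpTo g b × v ∈ map (suc b ∷_) (g (suc b)) → ⊥
    disjoint (v∈ , v∈′) with ∈-map⁻ (suc b ∷_) v∈′
    ... | _ , _ , refl = ℕ.<-irrefl refl (proj₁ (∈-consUpTo⁻ b v∈))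

  length-consUpTo : ∀ b → length (consUpTo g (suc b)) ≡ length (consUpTo g b) + length (g (suc b))
  length-consUpTo b = trans (List.length-++ (consUpTo g b)) (cong (_+_ (length (consUpTo g b))) (List.length-map (suc b ∷_) (g (suc b))))

chainBound : ℕ → ℕ → ℕ
chainBound m h = (suc m * h) / suc (suc m)

-- the vectors (z_m, …, z_1, z_0), last entry first, with z_0 = 0, (k+2) z_k ≤ (k+1) z_{k+1} and z_m ≤ b
chains : (m : ℕ) → ℕ → List (Vec ℕ (suc m))
chains zero    b = List.[ 0 ∷ [] ]
chains (suc m) b = consUpTo (λ h → chains m (chainBound m h)) b

IsChain : (m : ℕ) → ℕ → Vec ℕ (suc m) → Set
IsChain zero    b (h ∷ []) = h ≡ 0
IsChain (suc m) b (h ∷ r)  = h ≤ b × IsChain m (chainBound m h) r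

∈-chains⇔ : ∀ m b r → r ∈ chains m b ⇔ IsChain m b r
∈-chains⇔ zero    b (h ∷ []) = mk⇔ (λ { (here h∷[]≡0∷[]) → Vec.∷-injectiveˡ h∷[]≡0∷[] }) (λ { refl → here refl })
∈-chains⇔ (suc m) b (h ∷ r)  = mk⇔
  (λ h∷r∈ → let h≤b , r∈ = ∈-consUpTo⁻ _ b h∷r∈ in h≤b , Equivalence.to (∈-chains⇔ m _ r) r∈)
  (λ (h≤b , r-chain) → ∈-consUpTo⁺ _ b h≤b (Equivalence.from (∈-chains⇔ m _ r) r-chain))

chains-unique : ∀ m b → Unique (chains m b)
chains-unique zero    b = All.[] AllPairs.∷ AllPairs.[]
chains-unique (suc m) b = consUpTo-unique _ (λ h → chains-unique m (chainBound m h)) b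

private
  #chains : ℕ → ℕ → ℕ
  #chains m b = length (chains m b)

  #chains-zero : ∀ m → #chains m 0 ≡ 1
  #chains-zero zero    = refl
  #chains-zero (suc m) = trans (List.length-map (0 ∷_) (chains m (chainBound m 0)))
    (trans (cong (λ z → #chains m (z / suc (suc m))) (ℕ.*-zeroʳ (suc m))) (#chains-zero m))

  chainBound-block : ∀ m q j → j ≤ suc m → chainBound m (suc (suc (suc m) * q + j)) ≡ suc m * q + j
  chainBound-block m q j j≤1+m = trans (cong (_/ suc (suc m)) split)
    (trans (+-distrib-/-∣ˡ (suc m ∸ j) (divides-refl (suc m * q + j)))
      (trans (cong₂ _+_ (m*n/n≡m (suc m * q + j) (suc (suc m))) (m<n⇒m/n≡0 (s≤s (ℕ.m∸n≤m (suc m) j))))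
        (ℕ.+-identityʳ _)))
    where
    e = suc m ∸ j
    identity : ∀ j e q → (j + e) * suc (suc (j + e) * q + j) ≡ ((j + e) * q + j) * suc (j + e) + e
    identity = ℕ-Solver.solve-∀
    split : suc m * suc (suc (suc m) * q + j) ≡ (suc m * q + j) * suc (suc m) + e
    split = subst (λ M → M * suc (suc M * q + j) ≡ (M * q + j) * suc M + e) (ℕ.m+[n∸m]≡n j≤1+m) (identity j e q)

  #chains-suc : ∀ m b → #chains (suc m) (suc b) ≡ #chains (suc m) b + #chains m (chainBound m (suc b))
  #chains-suc m b = length-consUpTo (λ h → chains m (chainBound m h)) b

  -- #chains m ((m+1) q + j) = (q+1)^(m+1-j) (q+2)^j - q^(m+1-j) (q+1)^j, stated without truncated subtraction
  ClosedFormAt : ℕ → ℕ → ℕ → Set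
  ClosedFormAt m q j = #chains m (suc m * q + j) + q ^ (suc m ∸ j) * suc q ^ j ≡ suc q ^ (suc m ∸ j) * suc (suc q) ^ j

  ClosedForm : ℕ → Set
  ClosedForm m = ∀ q j → j ≤ suc m → ClosedFormAt m q j

  closedForm-zero : ClosedForm 0
  closedForm-zero q zero          _         = identity q
    where
    identity : ∀ q → 1 + q * 1 * 1 ≡ suc q * 1 * 1
    identity = ℕ-Solver.solve-∀
  closedForm-zero q (suc zero)    _         = identity q
    where
    identity : ∀ q → 1 + 1 * (suc q * 1) ≡ 1 * (suc (suc q) * 1)
    identity = ℕ-Solver.solve-∀
  closedForm-zero q (suc (suc j)) (s≤s ())

  closedForm-combine : ∀ N₁ N₂ q a b c d → N₁ + (q * c) * d ≡ (suc q * a) * b → N₂ + c * d ≡ a * b →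
                       (N₁ + N₂) + c * (suc q * d) ≡ a * (suc (suc q) * b)
  closedForm-combine N₁ N₂ q a b c d e₁ e₂ = begin
    (N₁ + N₂) + c * (suc q * d)       ≡⟨ regroup N₁ N₂ q c d ⟩
    (N₁ + (q * c) * d) + (N₂ + c * d) ≡⟨ cong₂ _+_ e₁ e₂ ⟩
    (suc q * a) * b + a * b           ≡⟨ factor q a b ⟩
    a * (suc (suc q) * b)             ∎
    where
    open ≡-Reasoning
    regroup : ∀ N₁ N₂ q c d → (N₁ + N₂) + c * (suc q * d) ≡ (N₁ + (q * c) * d) + (N₂ + c * d)
    regroup = ℕ-Solver.solve-∀
    factor : ∀ q a b → (suc q * a) * b + a * b ≡ a * (suc (suc q) * b)
    factor = ℕ-Solver.solve-∀

  closedForm-suc : ∀ m → ClosedForm m → ClosedForm (suc m)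
  closedForm-suc m closedForm-m = closedForm
    where
    M = suc m
    Holds : ℕ → ℕ → Set
    Holds = ClosedFormAt M
    within-block : ∀ q → Holds q 0 → ∀ j → j ≤ suc M → Holds q j
    within-block q holds₀ zero    _         = holds₀
    within-block q holds₀ (suc j) (s≤s j≤M) = trans (cong (_+ q ^ e * suc q ^ suc j) #chains-step)
      (closedForm-combine (#chains M (suc M * q + j)) (#chains m (M * q + j)) q (suc q ^ e) (suc (suc q) ^ j) (q ^ e) (suc q ^ j)
        holds-j (closedForm-m q j j≤M))
      where
      e = M ∸ j
      holds-j : #chains M (suc M * q + j) + (q * q ^ e) * suc q ^ j ≡ (suc q * suc q ^ e) * suc (suc q) ^ j
      holds-j = subst (λ z → #chains M (suc M * q + j) + q ^ z * suc q ^ j ≡ suc q ^ z * suc (suc q) ^ j)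
        (ℕ.+-∸-assoc 1 j≤M) (within-block q holds₀ j (ℕ.m≤n⇒m≤1+n j≤M))
      #chains-step : #chains M (suc M * q + suc j) ≡ #chains M (suc M * q + j) + #chains m (M * q + j)
      #chains-step = trans (cong (#chains M) (ℕ.+-suc (suc M * q) j))
        (trans (#chains-suc m (suc M * q + j)) (cong (λ z → #chains M (suc M * q + j) + #chains m z) (chainBound-block m q j j≤M)))
    closedForm : ClosedForm M
    closedForm zero    = within-block zero holds₀
      where
      holds₀ : Holds zero 0
      holds₀ = trans (cong (λ z → #chains M z + 0) (trans (ℕ.+-identityʳ (suc M * 0)) (ℕ.*-zeroʳ (suc M))))
        (trans (cong (_+ 0) (#chains-zero M)) (sym (trans (ℕ.*-identityʳ _) (ℕ.^-zeroˡ (suc M)))))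
    closedForm (suc q) = within-block (suc q) holds₀
      where
      end-of-previous : Holds q (suc M)
      end-of-previous = closedForm q (suc M) ℕ.≤-refl
      drop-power : ∀ a b → a ^ (suc M ∸ suc M) * b ≡ b
      drop-power a b = trans (cong (λ z → a ^ z * b) (ℕ.n∸n≡0 (suc M))) (ℕ.*-identityˡ b)
      index : suc M * suc q + 0 ≡ suc M * q + suc M
      index = trans (ℕ.+-identityʳ _) (trans (ℕ.*-suc (suc M) q) (ℕ.+-comm (suc M) _))
      holds₀ : Holds (suc q) 0
      holds₀ = begin
        #chains M (suc M * suc q + 0) + suc q ^ suc M * 1                   ≡⟨ cong₂ (λ b z → #chains M b + z) index (ℕ.*-identityʳ _) ⟩
        #chains M (suc M * q + suc M) + suc q ^ suc M                       ≡⟨ cong (_+_ (#chains M (suc M * q + suc M))) (drop-power q _) ⟨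
        #chains M (suc M * q + suc M) + q ^ (suc M ∸ suc M) * suc q ^ suc M ≡⟨ end-of-previous ⟩
        suc q ^ (suc M ∸ suc M) * suc (suc q) ^ suc M                       ≡⟨ drop-power (suc q) _ ⟩
        suc (suc q) ^ suc M                                                 ≡⟨ ℕ.*-identityʳ _ ⟨
        suc (suc q) ^ suc M * 1                                             ∎
        where open ≡-Reasoning

length-chains : ∀ m t → length (chains m (suc m * t)) ≡ suc t ^ suc m ∸ t ^ suc m
length-chains m t = begin
  #chains m (suc m * t)                         ≡⟨ ℕ.m+n∸n≡m _ (t ^ suc m) ⟨
  #chains m (suc m * t) + t ^ suc m ∸ t ^ suc m ≡⟨ cong (_∸ t ^ suc m) (trans (cong₂ (λ b z → #chains m b + z)
                                                            (sym (ℕ.+-identityʳ _)) (sym (ℕ.*-identityʳ _))) (closedForm m t 0 z≤n)) ⟩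
  suc t ^ suc m * 1 ∸ t ^ suc m ≡⟨ cong (_∸ t ^ suc m) (ℕ.*-identityʳ _) ⟩
  suc t ^ suc m ∸ t ^ suc m     ∎
  where
  open ≡-Reasoning
  closedForm : ∀ m → ClosedForm m
  closedForm zero    = closedForm-zero
  closedForm (suc m) = closedForm-suc m (closedForm m)

-- Chains as lattice points of t·Q_n

ChainCondition : ℕ → ℕ → (ℕ → ℕ) → Set
ChainCondition m b Z = (Z 0 ≡ 0) × (∀ k → k < m → suc (suc k) * Z k ≤ suc k * Z (suc k)) × (Z m ≤ b)

*≤⇔≤/ : ∀ d z a .{{_ : ℕ.NonZero d}} → d * z ≤ a ⇔ z ≤ a / d
*≤⇔≤/ d z a = mk⇔
  (λ d*z≤a → subst (_≤ a / d) (m*n/n≡m z d) (/-monoˡ-≤ d (subst (_≤ a) (ℕ.*-comm d z) d*z≤a)))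
  (λ z≤a/d → subst (_≤ a) (ℕ.*-comm z d) (ℕ.≤-trans (ℕ.*-monoˡ-≤ d z≤a/d) (m/n*n≤m a d)))

isChain⇔chainCondition : ∀ m b r → IsChain m b r ⇔ ChainCondition m b (λ k → at 0 r (m ∸ k))
isChain⇔chainCondition zero    b (h ∷ []) = mk⇔ (λ { refl → refl , (λ _ ()) , z≤n }) proj₁
isChain⇔chainCondition (suc m) b (h ∷ r)  = mk⇔ to from
  where
  Z Z′ : ℕ → ℕ
  Z  k = at 0 (h ∷ r) (suc m ∸ k)
  Z′ k = at 0 r (m ∸ k)
  Z≡Z′ : ∀ k → k ≤ m → Z k ≡ Z′ k
  Z≡Z′ k k≤m = cong (at 0 (h ∷ r)) (ℕ.+-∸-assoc 1 k≤m)
  Z-last : Z (suc m) ≡ h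
  Z-last = cong (at 0 (h ∷ r)) (ℕ.n∸n≡0 m)
  Step : (ℕ → ℕ) → ℕ → Set
  Step Z k = suc (suc k) * Z k ≤ suc k * Z (suc k)
  step≡ : ∀ k → k < m → Step Z′ k ≡ Step Z k
  step≡ k k<m = cong₂ (λ u v → suc (suc k) * u ≤ suc k * v) (sym (Z≡Z′ k (ℕ.<⇒≤ k<m))) (sym (Z≡Z′ (suc k) k<m))
  last-step : Step Z m ⇔ Z′ m ≤ chainBound m h
  last-step = subst (λ P → P ⇔ Z′ m ≤ chainBound m h)
    (cong₂ (λ u v → suc (suc m) * u ≤ suc m * v) (sym (Z≡Z′ m ℕ.≤-refl)) (sym Z-last))
    (*≤⇔≤/ (suc (suc m)) (Z′ m) (suc m * h))
  to : IsChain (suc m) b (h ∷ r) → ChainCondition (suc m) b Z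
  to (h≤b , r-chain) with Equivalence.to (isChain⇔chainCondition m (chainBound m h) r) r-chain
  ... | Z′₀≡0 , Z′-steps , Z′-last = trans (Z≡Z′ 0 z≤n) Z′₀≡0 , steps , subst (_≤ b) (sym Z-last) h≤b
    where
    steps : ∀ k → k < suc m → Step Z k
    steps k k<1+m with ℕ.m<1+n⇒m<n∨m≡n k<1+m
    ... | inj₁ k<m  = subst id (step≡ k k<m) (Z′-steps k k<m)
    ... | inj₂ refl = Equivalence.from last-step Z′-last
  from : ChainCondition (suc m) b Z → IsChain (suc m) b (h ∷ r)
  from (Z₀≡0 , steps , Z-last≤b) = subst (_≤ b) Z-last Z-last≤b ,
    Equivalence.from (isChain⇔chainCondition m (chainBound m h) r)
      (trans (sym (Z≡Z′ 0 z≤n)) Z₀≡0 ,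
       (λ k k<m → subst id (sym (step≡ k k<m)) (steps k (ℕ.m<n⇒m<1+n k<m))) ,
       Equivalence.to last-step (steps m ℕ.≤-refl))

private
  [c-a]≤[c-b]⇔b≤a : ∀ c a b → c ℤ.- a ℤ.≤ c ℤ.- b ⇔ b ℤ.≤ a
  [c-a]≤[c-b]⇔b≤a c a b = mk⇔
    (λ le → ℤ.neg-cancel-≤ (subst₂ ℤ._≤_ (cancel c a) (cancel c b) (ℤ.+-monoʳ-≤ (ℤ.- c) le)))
    (λ b≤a → ℤ.+-monoʳ-≤ c (ℤ.neg-mono-≤ b≤a))
    where
    cancel : ∀ c a → ℤ.- c ℤ.+ (c ℤ.- a) ≡ ℤ.- a
    cancel = ℤ-Solver.solve-∀

  0≤c-a⇔a≤c : ∀ c a → + 0 ℤ.≤ c ℤ.- a ⇔ a ℤ.≤ c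
  0≤c-a⇔a≤c c a = mk⇔ ℤ.0≤i-j⇒j≤i ℤ.i≤j⇒0≤j-i

  c-[c-a]≡a : ∀ c a → c ℤ.- (c ℤ.- a) ≡ a
  c-[c-a]≡a = ℤ-Solver.solve-∀

  c-a≡c⇔a≡0 : ∀ c a → c ℤ.- a ≡ c ⇔ a ≡ + 0
  c-a≡c⇔a≡0 c a = mk⇔
    (λ eq → trans (sym (c-[c-a]≡a c a)) (trans (cong (ℤ._-_ c) eq) (ℤ.+-inverseʳ c)))
    (λ { refl → ℤ.+-identityʳ c })

  c-a≡c-b⇒a≡b : ∀ c a b → c ℤ.- a ≡ c ℤ.- b → a ≡ b
  c-a≡c-b⇒a≡b c a b eq = trans (sym (c-[c-a]≡a c a)) (trans (cong (ℤ._-_ c) eq) (c-[c-a]≡a c b))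

  pos-*-minus : ∀ c s z → + c ℤ.* (+ s ℤ.- + z) ≡ + (c * s) ℤ.- + (c * z)
  pos-*-minus c s z = trans (ℤ.*-distribˡ-+ (+ c) (+ s) (ℤ.- + z))
    (cong₂ ℤ._+_ (sym (ℤ.pos-* c s)) (trans (sym (ℤ.neg-distribʳ-* (+ c) (+ z))) (cong ℤ.-_ (sym (ℤ.pos-* c z)))))

module _ (m t : ℕ) (Y : ℕ → ℤ) (Z : ℕ → ℕ) (Y≡ : ∀ k → k ≤ m → Y k ≡ + (suc k * t) ℤ.- + Z k) where

  QInequalities⇔ChainCondition : QInequalities (suc m) t Y ⇔ ChainCondition m (suc m * t) Z
  QInequalities⇔ChainCondition = mk⇔
    (λ (Y₀≡t , steps , 0≤Yₘ) → Equivalence.to first Y₀≡t , (λ k k<m → Equivalence.to (step k k<m) (steps k (s≤s k<m))) ,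
                                Equivalence.to last 0≤Yₘ)
    (λ (Z₀≡0 , steps , Zₘ≤b) → Equivalence.from first Z₀≡0 , (λ { k (s≤s k<m) → Equivalence.from (step k k<m) (steps k k<m) }) ,
                                Equivalence.from last Zₘ≤b)
    where
    open import Relation.Binary.Reasoning.Setoid (⇔-setoid 0ℓ)
    +≤+⇔ : ∀ {a b} → + a ℤ.≤ + b ⇔ a ≤ b
    +≤+⇔ = mk⇔ ℤ.drop‿+≤+ ℤ.+≤+
    first : Y 0 ≡ + t ⇔ Z 0 ≡ 0
    first = begin
      Y 0 ≡ + t           ≡⟨ cong (_≡ + t) (trans (Y≡ 0 z≤n) (cong (λ c → + c ℤ.- + Z 0) (ℕ.*-identityˡ t))) ⟩
      + t ℤ.- + Z 0 ≡ + t ≈⟨ c-a≡c⇔a≡0 (+ t) (+ Z 0) ⟩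
      + Z 0 ≡ + 0         ≈⟨ mk⇔ ℤ.+-injective (cong (λ z → + z)) ⟩
      Z 0 ≡ 0             ∎
    step : ∀ k → k < m → (+ suc k ℤ.* Y (suc k) ℤ.≤ + suc (suc k) ℤ.* Y k) ⇔ (suc (suc k) * Z k ≤ suc k * Z (suc k))
    step k k<m = begin
      + suc k ℤ.* Y (suc k) ℤ.≤ + suc (suc k) ℤ.* Y k
        ≡⟨ cong₂ ℤ._≤_ (trans (cong (+ suc k ℤ.*_) (Y≡ (suc k) k<m)) (pos-*-minus (suc k) (suc (suc k) * t) (Z (suc k))))
                        (trans (cong (+ suc (suc k) ℤ.*_) (Y≡ k (ℕ.<⇒≤ k<m))) (pos-*-minus (suc (suc k)) (suc k * t) (Z k))) ⟩
      + (suc k * (suc (suc k) * t)) ℤ.- + (suc k * Z (suc k)) ℤ.≤ + (suc (suc k) * (suc k * t)) ℤ.- + (suc (suc k) * Z k)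
        ≡⟨ cong (λ c → + c ℤ.- + (suc k * Z (suc k)) ℤ.≤ + (suc (suc k) * (suc k * t)) ℤ.- + (suc (suc k) * Z k))
                (ℕ-*.x∙yz≈y∙xz (suc k) (suc (suc k)) t) ⟩
      + (suc (suc k) * (suc k * t)) ℤ.- + (suc k * Z (suc k)) ℤ.≤ + (suc (suc k) * (suc k * t)) ℤ.- + (suc (suc k) * Z k)
        ≈⟨ [c-a]≤[c-b]⇔b≤a (+ (suc (suc k) * (suc k * t))) (+ (suc k * Z (suc k))) (+ (suc (suc k) * Z k)) ⟩
      + (suc (suc k) * Z k) ℤ.≤ + (suc k * Z (suc k))
        ≈⟨ +≤+⇔ ⟩
      suc (suc k) * Z k ≤ suc k * Z (suc k)
        ∎
    last : + 0 ℤ.≤ Y m ⇔ Z m ≤ suc m * t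
    last = begin
      + 0 ℤ.≤ Y m                     ≡⟨ cong (+ 0 ℤ.≤_) (Y≡ m ℕ.≤-refl) ⟩
      + 0 ℤ.≤ + (suc m * t) ℤ.- + Z m ≈⟨ 0≤c-a⇔a≤c _ _ ⟩
      + Z m ℤ.≤ + (suc m * t)         ≈⟨ +≤+⇔ ⟩
      Z m ≤ suc m * t                 ∎

QInequalities⇒≤ : ∀ m t Y → QInequalities (suc m) t Y → ∀ k → k ≤ m → Y k ℤ.≤ + (suc k * t)
QInequalities⇒≤ m t Y (Y₀≡t , steps , _) zero    _       = ℤ.≤-reflexive (trans Y₀≡t (cong (λ z → + z) (sym (ℕ.*-identityˡ t))))
QInequalities⇒≤ m t Y ineq@(_ , steps , _) (suc k) 1+k≤m = ℤ.*-cancelˡ-≤-pos (Y (suc k)) (+ (suc (suc k) * t)) (+ suc k) (begin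
  + suc k ℤ.* Y (suc k)           ≤⟨ steps k (s≤s 1+k≤m) ⟩
  + suc (suc k) ℤ.* Y k           ≤⟨ ℤ.*-monoˡ-≤-nonNeg (+ suc (suc k)) (QInequalities⇒≤ m t Y ineq k (ℕ.<⇒≤ 1+k≤m)) ⟩
  + suc (suc k) ℤ.* + (suc k * t) ≡⟨ sym (ℤ.pos-* (suc (suc k)) (suc k * t)) ⟩
  + (suc (suc k) * (suc k * t))   ≡⟨ cong (λ z → + z) (ℕ-*.x∙yz≈y∙xz (suc (suc k)) (suc k) t) ⟩
  + (suc k * (suc (suc k) * t))   ≡⟨ ℤ.pos-* (suc k) _ ⟩
  + suc k ℤ.* + (suc (suc k) * t) ∎)
  where open ℤ.≤-Reasoning

chainCondition-cong : ∀ {m b Z Z′} → (∀ k → k ≤ m → Z k ≡ Z′ k) → ChainCondition m b Z → ChainCondition m b Z′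
chainCondition-cong {m} {b} Z≡Z′ (Z₀≡0 , steps , Zₘ≤b) = trans (sym (Z≡Z′ 0 z≤n)) Z₀≡0 ,
  (λ k k<m → subst₂ (λ u v → suc (suc k) * u ≤ suc k * v) (Z≡Z′ k (ℕ.<⇒≤ k<m)) (Z≡Z′ (suc k) k<m) (steps k k<m)) ,
  subst (_≤ b) (Z≡Z′ m ℕ.≤-refl) Zₘ≤b

module QPoints (m t : ℕ) where

  fromChain : Vec ℕ (suc m) → Vec ℤ (suc m)
  fromChain r = tabulateℕ (suc m) (λ k → + (suc k * t) ℤ.- + at 0 r (m ∸ k))

  qPoints : List (Vec ℤ (suc m))
  qPoints = map fromChain (chains m (suc m * t))

  at-fromChain : ∀ r k → k ≤ m → at (+ 0) (fromChain r) k ≡ + (suc k * t) ℤ.- + at 0 r (m ∸ k)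
  at-fromChain r k k≤m = at-tabulateℕ (+ 0) (λ k → + (suc k * t) ℤ.- + at 0 r (m ∸ k)) (s≤s k≤m)

  fromChain-injective : ∀ {r r′} → fromChain r ≡ fromChain r′ → r ≡ r′
  fromChain-injective {r} {r′} eq = at-injective 0 r r′ λ i i<1+m →
    let k = m ∸ i
        k≤m = ℕ.m∸n≤m m i
    in subst (λ i → at 0 r i ≡ at 0 r′ i) (ℕ.m∸[m∸n]≡n (ℕ.≤-pred i<1+m)) (ℤ.+-injective
         (c-a≡c-b⇒a≡b (+ (suc k * t)) _ _
           (trans (sym (at-fromChain r k k≤m)) (trans (cong (λ y → at (+ 0) y k) eq) (at-fromChain r′ k k≤m)))))

  qPoints-unique : Unique qPoints
  qPoints-unique = Unique.map⁺ fromChain-injective (chains-unique m (suc m * t))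

  length-qPoints : length qPoints ≡ suc t ^ suc m ∸ t ^ suc m
  length-qPoints = trans (List.length-map fromChain (chains m (suc m * t))) (length-chains m t)

  ∈-qPoints⇔ : ∀ y → y ∈ qPoints ⇔ QInequalities (suc m) t (at (+ 0) y)
  ∈-qPoints⇔ y = mk⇔ to from
    where
    to : y ∈ qPoints → QInequalities (suc m) t (at (+ 0) y)
    to y∈ with ∈-map⁻ fromChain y∈
    ... | r , r∈ , refl = Equivalence.from (QInequalities⇔ChainCondition m t _ (λ k → at 0 r (m ∸ k)) (at-fromChain r))
      (Equivalence.to (isChain⇔chainCondition m _ r) (Equivalence.to (∈-chains⇔ m _ r) r∈))
    from : QInequalities (suc m) t (at (+ 0) y) → y ∈ qPoints
    from ineq = subst (_∈ qPoints) (sym y≡) (∈-map⁺ fromChain r∈)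
      where
      Z : ℕ → ℕ
      Z k = ℤ.∣ + (suc k * t) ℤ.- at (+ 0) y k ∣
      +Z≡ : ∀ k → k ≤ m → + Z k ≡ + (suc k * t) ℤ.- at (+ 0) y k
      +Z≡ k k≤m = ℤ.0≤i⇒+∣i∣≡i (ℤ.i≤j⇒0≤j-i (QInequalities⇒≤ m t _ ineq k k≤m))
      y≡ₖ : ∀ k → k ≤ m → at (+ 0) y k ≡ + (suc k * t) ℤ.- + Z k
      y≡ₖ k k≤m = trans (sym (c-[c-a]≡a (+ (suc k * t)) (at (+ 0) y k))) (cong (ℤ._-_ (+ (suc k * t))) (sym (+Z≡ k k≤m)))
      r : Vec ℕ (suc m)
      r = tabulateℕ (suc m) (λ i → Z (m ∸ i))
      r≡Z : ∀ k → k ≤ m → Z k ≡ at 0 r (m ∸ k)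
      r≡Z k k≤m = sym (trans (at-tabulateℕ 0 (λ i → Z (m ∸ i)) (s≤s (ℕ.m∸n≤m m k))) (cong Z (ℕ.m∸[m∸n]≡n k≤m)))
      r∈ : r ∈ chains m (suc m * t)
      r∈ = Equivalence.from (∈-chains⇔ m _ r) (Equivalence.from (isChain⇔chainCondition m _ r)
             (chainCondition-cong {Z = Z} r≡Z (Equivalence.to (QInequalities⇔ChainCondition m t _ Z y≡ₖ) ineq)))
      y≡ : y ≡ fromChain r
      y≡ = at-injective (+ 0) y (fromChain r) λ k k<1+m → let k≤m = ℕ.≤-pred k<1+m in
        trans (y≡ₖ k k≤m) (trans (cong (λ z → + (suc k * t) ℤ.- + z) (r≡Z k k≤m)) (sym (at-fromChain r k k≤m)))

Λ≡Λℕ : ∀ n (a b : Fin n) → Λ n a b ≡ Λℕ (toℕ a) (toℕ b)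
Λ≡Λℕ n a b with toℕ b ℕ.<? suc (toℕ a)
... | yes _ = refl
... | no  _ = refl

ehrIs-Λ : ∀ m t′ → EhrIs (Λ (suc m)) (suc t′) (suc (suc t′) ^ suc m ∸ suc t′ ^ suc m)
ehrIs-Λ m t′ = qPoints , qPoints-unique , membership , length-qPoints
  where
  open QPoints m (suc t′)
  open import Relation.Binary.Reasoning.Setoid (⇔-setoid 0ℓ)
  membership : ∀ x → x ∈ qPoints ⇔ InDilatedHull (Λ (suc m)) (suc t′) x
  membership x = begin
    x ∈ qPoints                                                        ≈⟨ ∈-qPoints⇔ x ⟩
    QInequalities (suc m) (suc t′) (at (+ 0) x)                        ≈⟨ inDilatedHull-Λℕ⇔QInequalities m t′ x ⟨
    InDilatedHullℕ (suc m) (suc m) Λℕ (suc t′) (λ j → at (+ 0) x j /1) ≈⟨ inDilatedHull⇔ℕ (Λ (suc m)) Λℕ (Λ≡Λℕ (suc m)) (suc t′) x ⟨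
    InDilatedHull (Λ (suc m)) (suc t′) x                               ∎

binomialImage : ∀ n → Vec ℤ n → Vec ℤ n
binomialImage n y = tabulateℕ n (binomialTransform n (at (+ 0) y))

at-binomialImage : ∀ n y j → j < n → at (+ 0) (binomialImage n y) j ≡ binomialTransform n (at (+ 0) y) j
at-binomialImage n y j j<n = at-tabulateℕ (+ 0) (binomialTransform n (at (+ 0) y)) j<n

binomialImage-injective : ∀ n {y y′} → binomialImage n y ≡ binomialImage n y′ → y ≡ y′
binomialImage-injective n {y} {y′} eq = at-injective (+ 0) y y′ (binomialTransform-injective n _ _ λ j j<n →
  trans (sym (at-binomialImage n y j j<n)) (trans (cong (λ z → at (+ 0) z j) eq) (at-binomialImage n y′ j j<n)))

ehrIs-Ω : ∀ m t′ → EhrIs (Ω (suc m)) (suc t′) (suc (suc t′) ^ suc m ∸ suc t′ ^ suc m)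
ehrIs-Ω m t′ = pPoints , Unique.map⁺ (binomialImage-injective n) qPoints-unique , membership ,
                 trans (List.length-map (binomialImage n) qPoints) length-qPoints
  where
  open QPoints m (suc t′)
  open import Relation.Binary.Reasoning.Setoid (⇔-setoid 0ℓ)
  n = suc m
  pPoints : List (Vec ℤ n)
  pPoints = map (binomialImage n) qPoints
  ∈-pPoints⇔ : ∀ x → x ∈ pPoints ⇔ InBinomialImageOfQ n (suc t′) (at (+ 0) x)
  ∈-pPoints⇔ x = mk⇔ to from
    where
    to : x ∈ pPoints → InBinomialImageOfQ n (suc t′) (at (+ 0) x)
    to x∈ with ∈-map⁻ (binomialImage n) x∈
    ... | y , y∈ , refl = y , Equivalence.to (∈-qPoints⇔ y) y∈ , at-binomialImage n y
    from : InBinomialImageOfQ n (suc t′) (at (+ 0) x) → x ∈ pPoints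
    from (y , ineq , x≡) = subst (_∈ pPoints) (sym (at-injective (+ 0) x (binomialImage n y)
      (λ j j<n → trans (x≡ j j<n) (sym (at-binomialImage n y j j<n)))))
      (∈-map⁺ (binomialImage n) (Equivalence.from (∈-qPoints⇔ y) ineq))
  membership : ∀ x → x ∈ pPoints ⇔ InDilatedHull (Ω n) (suc t′) x
  membership x = begin
    x ∈ pPoints                                            ≈⟨ ∈-pPoints⇔ x ⟩
    InBinomialImageOfQ n (suc t′) (at (+ 0) x)             ≈⟨ inDilatedHull-Ωℕ⇔InBinomialImageOfQ m t′ (at (+ 0) x) ⟨
    InDilatedHullℕ n n Ωℕ (suc t′) (λ j → at (+ 0) x j /1) ≈⟨ inDilatedHull⇔ℕ (Ω n) Ωℕ (λ _ _ → refl) (suc t′) x ⟨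
    InDilatedHull (Ω n) (suc t′) x                         ∎

mainTheorem13 : (n t : ℕ) → n ≥ 1 → t ≥ 1 →
    EhrIs (Ω n) t ((t + 1) ^ n ∸ t ^ n) × EhrIs (Λ n) t ((t + 1) ^ n ∸ t ^ n)
mainTheorem13 (suc m) (suc t′) _ _ =
  subst (λ c → EhrIs (Ω (suc m)) (suc t′) c × EhrIs (Λ (suc m)) (suc t′) c)
        (cong (λ s → s ^ suc m ∸ suc t′ ^ suc m) (ℕ.+-comm 1 (suc t′)))
        (ehrIs-Ω m t′ , ehrIs-Λ m t′)
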